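{- Let $n\ge2$ and let $\mathcal{A}^B_n$ be the set of $B$-arc permutations in $B_n$. Then $$\sum_{\pi\in\mathcal{A}^B_n} \mathbf{x}^{\mathrm{Des}(\pi)}= \prod_{i=1}^{n-1}(1+x_i)\left(2+n+2\sum_{i=1}^{n-2}\frac{x_i+x_{i+1}}{(1+x_i)(1+x_{i+1})}\right).$$
   Context: $B_n$ is the group of bijections $\pi$ of $\{\pm1,\dots,\pm n\}$ with $\pi(-a)=-\pi(a)$, written $\pi=[\pi(1),\dots,\pi(n)]$. Let $\mathcal{O}_n$ be a circle with $2n$ points labeled $-1,\dots,-n,1,\dots,n$ in clockwise order; an interval in $\mathcal{O}_n$ is a set of cyclically consecutive points. $\pi\in B_n$ is a $B$-arc permutation if for every $1\le j\le n$ the set $\{\pi(j),\dots,\pi(n)\}$ is an interval in $\mathcal{O}_n$. Descents are with respect to the order $-1<-2<\cdots<-n<1<\cdots<n$: $\mathrm{Des}(\pi)=\{1\le i\le n-1:\pi(i)>\pi(i+1)\}$. For $D=\{i_1,\dots,i_k\}$, $\mathbf{x}^D=x_{i_1}\cdots x_{i_k}$. -}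

module Defs where

open import Level using (Level)
open import Data.Nat as ℕ using (ℕ; zero; suc; _+_; _*_; _∸_; _<_; _≤_)
open import Data.Nat.Properties using (_≟_; _<?_)
open import Data.Bool using (Bool; true; false; if_then_else_)
open import Data.Fin as Fin using (Fin; toℕ)
import Data.Fin.Properties as FinP
open import Data.List using (List; []; _∷_; map; _++_; concatMap; filter; upTo; foldr; drop; allFin)
open import Data.List.Membership.DecPropositional (_≟_) using (_∈_; _∈?_)
open import Data.Vec as Vec using (Vec; toList)
open import Data.Product using (Σ; _×_; _,_; ∃)
open import Data.Sum using (_⊎_)
open import Relation.Binary.PropositionalEquality using (_≡_)
open import Relation.Nullary using (Dec; yes; no; does)
open import Relation.Nullary.Decidable using (_×-dec_; _⊎-dec_; _→-dec_)
open import Relation.Unary using (Decidable)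
open import Algebra.Bundles using (CommutativeRing)

-- Signed letters ±1,…,±n.  pos k stands for k+1, neg k for -(k+1).

data Signed (n : ℕ) : Set where
  pos : Fin n → Signed n
  neg : Fin n → Signed n

∣_∣ˢ : ∀ {n} → Signed n → Fin n
∣ pos k ∣ˢ = k
∣ neg k ∣ˢ = k

allSigned : (n : ℕ) → List (Signed n)
allSigned n = map neg (allFin n) ++ map pos (allFin n)

-- Rank in the total order  -1 < -2 < ⋯ < -n < 1 < ⋯ < n.
rank : ∀ {n} → Signed n → ℕ
rank {n} (neg k) = toℕ k
rank {n} (pos k) = n + toℕ k

-- Position on the circle O_n, whose 2n points -1,…,-n,1,…,n are listed
-- clockwise; positions are 0,…,2n-1 in clockwise order.
circlePos : ∀ {n} → Signed n → ℕ
circlePos {n} (neg k) = toℕ k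
circlePos {n} (pos k) = n + toℕ k

-- A signed permutation π ∈ B_n is determined by the
-- word [π(1),…,π(n)] (π(-a) = -π(a)); such a word comes from a
-- bijection of {±1,…,±n} iff the absolute values are pairwise distinct.

Word : ℕ → Set
Word n = Vec (Signed n) n

AbsDistinct : ∀ {n} → Word n → Set
AbsDistinct {n} w = (i j : Fin n) → ∣ Vec.lookup w i ∣ˢ ≡ ∣ Vec.lookup w j ∣ˢ → i ≡ j

absDistinct? : ∀ {n} → Decidable (AbsDistinct {n})
absDistinct? w = FinP.all? λ i → FinP.all? λ j →
  (∣ Vec.lookup w i ∣ˢ FinP.≟ ∣ Vec.lookup w j ∣ˢ) →-dec (i FinP.≟ j)

allWords : ∀ {A : Set} → List A → (m : ℕ) → List (Vec A m)
allWords L zero    = Vec.[] ∷ []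
allWords L (suc m) = concatMap (λ a → map (a Vec.∷_) (allWords L m)) L

allB : (n : ℕ) → List (Word n)
allB n = filter absDistinct? (allWords (allSigned n) n)

-- A set S of
-- positions (⊆ {0,…,2n-1}) is an interval iff there are a start s < 2n
-- and a length ℓ ≤ 2n such that S = {s, s+1, …, s+ℓ-1} taken mod 2n.

InArc : (n s ℓ p : ℕ) → Set
InArc n s ℓ p = ∃ λ (t : Fin ℓ) → (s + toℕ t ≡ p) ⊎ (s + toℕ t ≡ 2 * n + p)

inArc? : ∀ n s ℓ p → Dec (InArc n s ℓ p)
inArc? n s ℓ p = FinP.any? λ t → (s + toℕ t ≟ p) ⊎-dec (s + toℕ t ≟ 2 * n + p)

IsInterval : (n : ℕ) → List ℕ → Set
IsInterval n S =
  Σ (Fin (2 * n)) λ s → Σ (Fin (suc (2 * n))) λ ℓ →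
    (p : Fin (2 * n)) →
      (toℕ p ∈ S → InArc n (toℕ s) (toℕ ℓ) (toℕ p)) ×
      (InArc n (toℕ s) (toℕ ℓ) (toℕ p) → toℕ p ∈ S)

isInterval? : ∀ n S → Dec (IsInterval n S)
isInterval? n S = FinP.any? λ s → FinP.any? λ ℓ → FinP.all? λ p →
  ((toℕ p ∈? S) →-dec inArc? n (toℕ s) (toℕ ℓ) (toℕ p)) ×-dec
  (inArc? n (toℕ s) (toℕ ℓ) (toℕ p) →-dec (toℕ p ∈? S))

-- π is a B-arc permutation iff for every 1 ≤ j ≤ n the set
-- {π(j),…,π(n)} is an interval of O_n.  (j = toℕ k + 1 for k : Fin n.)
IsBArc : ∀ {n} → Word n → Set
IsBArc {n} w = (k : Fin n) → IsInterval n (map circlePos (drop (toℕ k) (toList w)))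

isBArc? : ∀ {n} → Decidable (IsBArc {n})
isBArc? {n} w = FinP.all? λ k → isInterval? n (map circlePos (drop (toℕ k) (toList w)))

arcB : (n : ℕ) → List (Word n)
arcB n = filter isBArc? (allB n)

-- desAfter i a ws : descents of the word a ∷ ws, where a sits at index i
desAfter : ∀ {n} → ℕ → Signed n → List (Signed n) → List ℕ
desAfter i a []       = []
desAfter i a (b ∷ ws) =
  if does (rank b <? rank a) then i ∷ desAfter (suc i) b ws else desAfter (suc i) b ws

desFrom : ∀ {n} → ℕ → List (Signed n) → List ℕ
desFrom i []       = []
desFrom i (a ∷ ws) = desAfter i a ws

Des : ∀ {n} → Word n → List ℕ
Des w = desFrom 1 (toList w)

module RingOps {c ℓ : Level} (R : CommutativeRing c ℓ) where
  open CommutativeRing R renaming (_+_ to _+ᴿ_; _*_ to _*ᴿ_)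

  Σᴿ : List Carrier → Carrier
  Σᴿ = foldr _+ᴿ_ 0#

  Πᴿ : List Carrier → Carrier
  Πᴿ = foldr _*ᴿ_ 1#

  natᴿ : ℕ → Carrier
  natᴿ zero    = 0#
  natᴿ (suc m) = 1# +ᴿ natᴿ m

  xPow : (ℕ → Carrier) → List ℕ → Carrier
  xPow x D = Πᴿ (map x D)

  -- [a, b] = {a, …, b} as a list (empty if b < a)
  range : ℕ → ℕ → List ℕ
  range a b = map (a +_) (upTo (suc b ∸ a))

  lhs : (n : ℕ) → (ℕ → Carrier) → Carrier
  lhs n x = Σᴿ (map (λ w → xPow x (Des w)) (arcB n))

  -- the right-hand side with the denominators cancelled:
  --   (2+n) ∏_{i=1}^{n-1} (1+x_i)
  --   + 2 ∑_{i=1}^{n-2} (x_i + x_{i+1}) ∏_{j ∈ [1,n-1], j ∉ {i,i+1}} (1+x_j)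
  rhs : (n : ℕ) → (ℕ → Carrier) → Carrier
  rhs n x =
    natᴿ (2 + n) *ᴿ Πᴿ (map (λ i → 1# +ᴿ x i) (range 1 (n ∸ 1)))
    +ᴿ natᴿ 2 *ᴿ Σᴿ (map (λ i → (x i +ᴿ x (suc i)) *ᴿ
         Πᴿ (map (λ j → 1# +ᴿ x j)
              (filter (λ j → Relation.Nullary.¬? ((j ≟ i) ⊎-dec (j ≟ suc i)))
                      (range 1 (n ∸ 1)))))
       (range 1 (n ∸ 2)))

module Submission where

-- Letters are identified with their positions 0, …, N-1 (N = 2n) on the
-- circle O_n; the order -1 < ⋯ < -n < 1 < ⋯ < n is the order of positions, so
-- descents can be read off positions.  A word is a B-arc permutation iff its positions enumerate an
--     arc of length n of O_n by repeatedly removing an endpoint, and the arc is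
--     then unique; so [π ∈ 𝒜^B_n] = Σ_s peelings s n π  (arcCount-indicator).
--  2. Transfer.  Weighting x^Des by these counts turns the left-hand side into
--     Σ_s arcWeight 0 0 s n, where arcWeight satisfies a two-term recursion on
--     the endpoint removed first  (lhs≈Σ-arcWeight).
--  3. Evaluation.  Arcs that do not wrap around have weight ∏ (1+x_j); wrapped
--     arcs, summed along antidiagonals, obey the recursion of the inner sum of
--     the right-hand side  (evaluation), which proves the theorem.

open import Defs
open import Level using (Level)
open import Algebra.Bundles using (CommutativeRing)
open import Data.Nat using (ℕ; zero; suc; _+_; _*_; _∸_; _<_; _≤_; z≤n; s≤s; s≤s⁻¹; NonZero; _≟_; _<?_)
open import Data.Nat.DivMod using (_%_; m<n⇒m%n≡m; m%n<n; n%n≡0; %-distribˡ-+; m%n%n≡m%n; m≤n⇒[n∸m]%m≡n%m; [m+n]%n≡m%n)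
import Data.Nat.Properties as ℕP
open import Data.Bool using (Bool; true; false; if_then_else_)
open import Data.Empty using (⊥; ⊥-elim)
open import Data.Sum using (_⊎_; inj₁; inj₂)
open import Data.Product using (_×_; _,_; ∃; proj₁; proj₂)
open import Data.Fin as Fin using (Fin; toℕ; fromℕ<)
import Data.Fin.Properties as FinP
open import Data.Vec as Vec using (Vec; toList; lookup)
open import Data.List using (List; []; _∷_; map; length; drop; _++_; concatMap; filter; tabulate; allFin; applyUpTo)
open import Data.List.Properties using (drop-map; map-∘; map-tabulate; map-applyUpTo; filter-accept; filter-reject; filter-all)
open import Data.List.Relation.Unary.Any using (here; there)
open import Data.List.Relation.Unary.All as All using (All; []; _∷_)
open import Data.List.Relation.Unary.All.Properties using (All¬⇒¬Any)
open import Data.List.Relation.Unary.AllPairs using (AllPairs; []; _∷_)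
open import Data.List.Membership.Propositional using (_∈_; _∉_)
open import Function using (_∘_)
open import Relation.Binary using (tri<; tri≈; tri>)
open import Relation.Binary.PropositionalEquality as ≡ using (_≡_; _≢_)
open import Relation.Nullary using (¬_; yes; no; does; Dec; ¬?)
open import Relation.Nullary.Decidable using (_⊎-dec_; dec-true; dec-false)
open import Relation.Unary using (Decidable)
import Algebra.Properties.Semiring.Mult as SemiringMult
import Algebra.Properties.CommutativeSemigroup as CommSemigroupProps
import Algebra.Solver.Ring.NaturalCoefficients.Default as NatCoeffSolver
import Relation.Binary.Reasoning.Setoid as SetoidReasoning

module Modular (N : ℕ) .{{_ : NonZero N}} where

  open ℕP
  open ≡ using (sym; trans; cong; module ≡-Reasoning)
  open ≡-Reasoning

  %-absorbˡ : ∀ x y → (x % N + y) % N ≡ (x + y) % N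
  %-absorbˡ x y = begin
    (x % N + y) % N          ≡⟨ %-distribˡ-+ (x % N) y N ⟩
    (x % N % N + y % N) % N  ≡⟨ cong (λ z → (z + y % N) % N) (m%n%n≡m%n x N) ⟩
    (x % N + y % N) % N      ≡⟨ %-distribˡ-+ x y N ⟨
    (x + y) % N              ∎

  +0-% : ∀ {s} → s < N → (s + 0) % N ≡ s
  +0-% {s} s<N = trans (cong (_% N) (+-identityʳ s)) (m<n⇒m%n≡m s<N)

  suc-% : ∀ s t → (suc s % N + t) % N ≡ (s + suc t) % N
  suc-% s t = trans (%-absorbˡ (suc s) t) (cong (_% N) (sym (+-suc s t)))

  suc-%ʳ : ∀ x → suc (x % N) % N ≡ suc x % N
  suc-%ʳ x = trans (cong (_% N) (+-comm 1 (x % N)))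
                   (trans (%-absorbˡ x 1) (cong (_% N) (+-comm x 1)))

  %-once : ∀ {x} → N ≤ x → x < N + N → x % N ≡ x ∸ N
  %-once {x} N≤x x<2N =
    trans (sym (m≤n⇒[n∸m]%m≡n%m N≤x)) (m<n⇒m%n≡m (m<n+o⇒m∸n<o x N x<2N))

  rotation-moves : ∀ r d → r < N → d < N → (r + d) % N ≡ r → d ≡ 0
  rotation-moves r d r<N d<N eq with r + d <? N
  ... | yes r+d<N = +-cancelˡ-≡ r d 0 (begin
    r + d        ≡⟨ m<n⇒m%n≡m r+d<N ⟨
    (r + d) % N  ≡⟨ eq ⟩
    r            ≡⟨ +-identityʳ r ⟨
    r + 0        ∎)
  ... | no r+d≮N = ⊥-elim (<-irrefl d≡N d<N)
    where
      N≤r+d : N ≤ r + d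
      N≤r+d = ≮⇒≥ r+d≮N
      d≡N : d ≡ N
      d≡N = +-cancelˡ-≡ r d N (begin
        r + d            ≡⟨ m∸n+n≡m N≤r+d ⟨
        (r + d ∸ N) + N  ≡⟨ cong (_+ N) (trans (sym (%-once N≤r+d (+-mono-< r<N d<N))) eq) ⟩
        r + N            ∎)

  +-cancelˡ-%-≤ : ∀ s {u v} → u ≤ v → v < N → (s + u) % N ≡ (s + v) % N → u ≡ v
  +-cancelˡ-%-≤ s {u} {v} u≤v v<N eq = begin
    u            ≡⟨ +-identityʳ u ⟨
    u + 0        ≡⟨ cong (u +_) gap≡0 ⟨
    u + (v ∸ u)  ≡⟨ m+[n∸m]≡n u≤v ⟩
    v            ∎
    where
      gap≡0 : v ∸ u ≡ 0
      gap≡0 = rotation-moves ((s + u) % N) (v ∸ u) (m%n<n (s + u) N)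
        (≤-<-trans (m∸n≤m v u) v<N) (begin
          ((s + u) % N + (v ∸ u)) % N  ≡⟨ %-absorbˡ (s + u) (v ∸ u) ⟩
          (s + u + (v ∸ u)) % N        ≡⟨ cong (_% N) (+-assoc s u (v ∸ u)) ⟩
          (s + (u + (v ∸ u))) % N      ≡⟨ cong (λ z → (s + z) % N) (m+[n∸m]≡n u≤v) ⟩
          (s + v) % N                  ≡⟨ eq ⟨
          (s + u) % N                  ∎)

  +-cancelˡ-% : ∀ s u v → u < N → v < N → (s + u) % N ≡ (s + v) % N → u ≡ v
  +-cancelˡ-% s u v u<N v<N eq with ≤-total u v
  ... | inj₁ u≤v = +-cancelˡ-%-≤ s u≤v v<N eq
  ... | inj₂ v≤u = sym (+-cancelˡ-%-≤ s v≤u u<N (sym eq))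

+-*-nonzero : ∀ x y z w → x * y + z * w ≢ 0 → (x ≢ 0 × y ≢ 0) ⊎ (z ≢ 0 × w ≢ 0)
+-*-nonzero x y z w h with x * y ≟ 0
... | no xy≢0 = inj₁ ((λ x≡0 → xy≢0 (≡.cong (_* y) x≡0)) ,
                      (λ y≡0 → xy≢0 (≡.trans (≡.cong (x *_) y≡0) (ℕP.*-zeroʳ x))))
... | yes xy≡0 = inj₂ ((λ z≡0 → h (≡.cong₂ _+_ xy≡0 (≡.cong (_* w) z≡0))) ,
                       (λ w≡0 → h (≡.cong₂ _+_ xy≡0 (≡.trans (≡.cong (z *_) w≡0) (ℕP.*-zeroʳ z)))))

sumBelow : ℕ → (ℕ → ℕ) → ℕ
sumBelow zero    f = 0
sumBelow (suc k) f = f 0 + sumBelow k (λ t → f (suc t))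

sumBelow-zero : ∀ k f → (∀ s → s < k → f s ≡ 0) → sumBelow k f ≡ 0
sumBelow-zero zero    f h = ≡.refl
sumBelow-zero (suc k) f h = ≡.cong₂ _+_ (h 0 (s≤s z≤n)) (sumBelow-zero k _ (λ s s<k → h (suc s) (s≤s s<k)))

sumBelow-single : ∀ k f s₀ → s₀ < k → f s₀ ≡ 1 → (∀ s → s < k → s ≢ s₀ → f s ≡ 0) → sumBelow k f ≡ 1
sumBelow-single (suc k) f zero _ f0≡1 h =
  ≡.cong₂ _+_ f0≡1 (sumBelow-zero k _ (λ s s<k → h (suc s) (s≤s s<k) (λ ())))
sumBelow-single (suc k) f (suc s₀) (s≤s s₀<k) fs₀≡1 h =
  ≡.cong₂ _+_ (h 0 (s≤s z≤n) (λ ()))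
    (sumBelow-single k _ s₀ s₀<k fs₀≡1 (λ s s<k s≢s₀ → h (suc s) (s≤s s<k) (s≢s₀ ∘ ℕP.suc-injective)))

module Peelings (n₀ : ℕ) where

  open ℕP
  open ≡ using (refl; sym; trans; cong; subst; subst₂; module ≡-Reasoning)

  n : ℕ
  n = suc n₀

  N : ℕ
  N = 2 * n

  open Modular N public

  n+n≡N : n + n ≡ N
  n+n≡N = cong (n +_) (sym (+-identityʳ n))

  n<N : n < N
  n<N = subst (n <_) n+n≡N (m<m+n n (s≤s z≤n))

  -- Peeling s m qs : the list qs enumerates the arc {s, s+1, …, s+m-1} (mod N)
  -- by repeatedly removing an endpoint: the head of qs is the left endpoint s
  -- or the right endpoint s+m-1, and the tail peels the remaining arc.
  data Peeling : ℕ → ℕ → List ℕ → Set where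
    single : ∀ {s b} → b ≡ s → Peeling s 1 (b ∷ [])
    left   : ∀ {s m b qs} → b ≡ s →
             Peeling (suc s % N) (suc m) qs → Peeling s (suc (suc m)) (b ∷ qs)
    right  : ∀ {s m b qs} → b ≡ (s + suc m) % N →
             Peeling s (suc m) qs → Peeling s (suc (suc m)) (b ∷ qs)

  endpoints-differ : ∀ {s m} → s < N → suc m < N → s ≢ (s + suc m) % N
  endpoints-differ {s} {m} s<N m<N eq
    with +-cancelˡ-% s 0 (suc m) (≤-<-trans z≤n m<N) m<N (trans (+0-% s<N) eq)
  ... | ()

  peeling-tail : ∀ {s m b qs} → s < N → Peeling s (suc (suc m)) (b ∷ qs) →
                 ∃ λ s' → s' < N × Peeling s' (suc m) qs
  peeling-tail {s} s<N (left _ peel)  = suc s % N , m%n<n (suc s) N , peel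
  peeling-tail s<N     (right _ peel) = _ , s<N , peel

  peeling-drop : ∀ {s m qs} → s < N → Peeling s m qs → ∀ k → k < m →
                 ∃ λ s' → s' < N × Peeling s' (m ∸ k) (drop k qs)
  peeling-drop s<N peel zero _ = _ , s<N , peel
  peeling-drop s<N (single _) (suc k) (s≤s ())
  peeling-drop s<N peel@(left _ _) (suc k) (s≤s k<m) with peeling-tail s<N peel
  ... | s' , s'<N , peel' = peeling-drop s'<N peel' k k<m
  peeling-drop s<N peel@(right _ _) (suc k) (s≤s k<m) with peeling-tail s<N peel
  ... | s' , s'<N , peel' = peeling-drop s'<N peel' k k<m

  δ : ℕ → ℕ → ℕ
  δ b s with b ≟ s
  ... | yes _ = 1
  ... | no _  = 0

  peelings : ℕ → ℕ → List ℕ → ℕ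
  peelings s 1 (b ∷ [])             = δ b s
  peelings s (suc (suc m)) (b ∷ qs) =
    δ b s * peelings (suc s % N) (suc m) qs + δ b ((s + suc m) % N) * peelings s (suc m) qs
  peelings _ _ _                    = 0

  δ-≡ : ∀ {b s} → b ≡ s → δ b s ≡ 1
  δ-≡ {b} {s} b≡s with b ≟ s
  ... | yes _   = refl
  ... | no b≢s  = ⊥-elim (b≢s b≡s)

  δ-≢ : ∀ {b s} → b ≢ s → δ b s ≡ 0
  δ-≢ {b} {s} b≢s with b ≟ s
  ... | yes b≡s = ⊥-elim (b≢s b≡s)
  ... | no _    = refl

  δ-nonzero : ∀ {b s} → δ b s ≢ 0 → b ≡ s
  δ-nonzero {b} {s} h with b ≟ s
  ... | yes b≡s = b≡s
  ... | no _    = ⊥-elim (h refl)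

  -- a peeling of an arc of length ≤ n is counted exactly once, since its
  -- head is either the left or the right endpoint, never both
  peeling⇒peelings≡1 : ∀ {s m qs} → s < N → m ≤ n → Peeling s m qs → peelings s m qs ≡ 1
  peeling⇒peelings≡1 s<N m≤n (single b≡s) = δ-≡ b≡s
  peeling⇒peelings≡1 {s} {suc (suc m)} s<N m≤n (left {b = b} b≡s peel)
    rewrite δ-≡ b≡s
          | peeling⇒peelings≡1 (m%n<n (suc s) N) (≤-trans (n≤1+n _) m≤n) peel
          | δ-≢ {b} {(s + suc m) % N} (λ b≡e → endpoints-differ s<N (<-trans m≤n n<N) (trans (sym b≡s) b≡e))
          = refl
  peeling⇒peelings≡1 {s} {suc (suc m)} s<N m≤n (right {b = b} b≡e peel)
    rewrite δ-≢ {b} {s} (λ b≡s → endpoints-differ s<N (<-trans m≤n n<N) (trans (sym b≡s) b≡e))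
          | δ-≡ b≡e
          | peeling⇒peelings≡1 s<N (≤-trans (n≤1+n _) m≤n) peel
          = refl

  peelings≢0⇒peeling : ∀ s m qs → peelings s m qs ≢ 0 → Peeling s m qs
  peelings≢0⇒peeling s 1 (b ∷ []) h = single (δ-nonzero h)
  peelings≢0⇒peeling s (suc (suc m)) (b ∷ qs) h with +-*-nonzero _ _ _ _ h
  ... | inj₁ (hd , tl) = left  (δ-nonzero hd) (peelings≢0⇒peeling _ _ _ tl)
  ... | inj₂ (hd , tl) = right (δ-nonzero hd) (peelings≢0⇒peeling _ _ _ tl)
  peelings≢0⇒peeling s zero qs h                   = ⊥-elim (h refl)
  peelings≢0⇒peeling s 1 [] h                      = ⊥-elim (h refl)
  peelings≢0⇒peeling s 1 (b ∷ c ∷ qs) h            = ⊥-elim (h refl)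
  peelings≢0⇒peeling s (suc (suc m)) [] h          = ⊥-elim (h refl)

  record IsArc (s ℓ : ℕ) (qs : List ℕ) : Set where
    field
      members  : ∀ {p} → p ∈ qs → ∃ λ t → t < ℓ × (s + t) % N ≡ p
      complete : ∀ t → t < ℓ → (s + t) % N ∈ qs

  open IsArc

  peeling⇒isArc : ∀ {s m qs} → s < N → Peeling s m qs → IsArc s m qs
  peeling⇒isArc s<N peel = record { members = mem s<N peel ; complete = com s<N peel }
    where
      mem : ∀ {s m qs} → s < N → Peeling s m qs → ∀ {p} → p ∈ qs → ∃ λ t → t < m × (s + t) % N ≡ p
      mem s<N (single b≡s)  (here p≡b) = 0 , s≤s z≤n , trans (+0-% s<N) (sym (trans p≡b b≡s))
      mem s<N (left b≡s _)  (here p≡b) = 0 , s≤s z≤n , trans (+0-% s<N) (sym (trans p≡b b≡s))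
      mem s<N (right b≡e _) (here p≡b) = _ , ≤-refl , sym (trans p≡b b≡e)
      mem {s} s<N (left _ peel) (there p∈) with mem (m%n<n (suc s) N) peel p∈
      ... | t , t<m , eq = suc t , s≤s t<m , trans (sym (suc-% s t)) eq
      mem s<N (right _ peel) (there p∈) with mem s<N peel p∈
      ... | t , t<m , eq = t , m<n⇒m<1+n t<m , eq

      com : ∀ {s m qs} → s < N → Peeling s m qs → ∀ t → t < m → (s + t) % N ∈ qs
      com s<N (single b≡s) zero _          = here (trans (+0-% s<N) (sym b≡s))
      com s<N (single _) (suc t) (s≤s ())
      com s<N (left b≡s _) zero _          = here (trans (+0-% s<N) (sym b≡s))
      com {s} s<N (left {qs = qs} _ peel) (suc t) (s≤s t<m) =
        there (subst (_∈ qs) (suc-% s t) (com (m%n<n (suc s) N) peel t t<m))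
      com s<N (right b≡e peel) t t<m with m≤n⇒m<n∨m≡n (s≤s⁻¹ t<m)
      ... | inj₁ t<m' = there (com s<N peel t t<m')
      ... | inj₂ refl = here (sym b≡e)

  -- Distinct points of the circle that are not antipodal, i.e. the
  -- positions of two letters with different absolute values.
  Apart : ℕ → ℕ → Set
  Apart a c = a ≢ c × a + n ≢ c × c + n ≢ a

  offsets-apart : ∀ s u v → u < n → v < n → u ≢ v → Apart ((s + u) % N) ((s + v) % N)
  offsets-apart s u v u<n v<n u≢v =
    (λ eq → u≢v (+-cancelˡ-% s u v (<-trans u<n n<N) (<-trans v<n n<N) eq)) ,
    not-antipodal u v u<n v<n ,
    not-antipodal v u v<n u<n
    where
      open ≡-Reasoning
      not-antipodal : ∀ u v → u < n → v < n → (s + u) % N + n ≢ (s + v) % N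
      not-antipodal u v u<n v<n eq = <⇒≱ v<n (subst (n ≤_) u+n≡v (m≤n+m n u))
        where
          u+n≡v : u + n ≡ v
          u+n≡v = +-cancelˡ-% s (u + n) v (subst (u + n <_) n+n≡N (+-monoˡ-< n u<n))
            (<-trans v<n n<N) (begin
              (s + (u + n)) % N      ≡⟨ cong (_% N) (+-assoc s u n) ⟨
              (s + u + n) % N        ≡⟨ %-absorbˡ (s + u) n ⟨
              ((s + u) % N + n) % N  ≡⟨ cong (_% N) eq ⟩
              (s + v) % N % N        ≡⟨ m%n%n≡m%n (s + v) N ⟩
              (s + v) % N            ∎)

  peeling⇒apart : ∀ {s m qs} → s < N → m ≤ n → Peeling s m qs → AllPairs Apart qs
  peeling⇒apart s<N m≤n (single _) = [] ∷ []
  peeling⇒apart {s} {suc (suc m)} s<N m≤n (left {qs = qs} b≡s peel') =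
    All.tabulate head-apart ∷ peeling⇒apart (m%n<n (suc s) N) (≤-trans (n≤1+n _) m≤n) peel'
    where
      head-apart : ∀ {c} → c ∈ qs → Apart _ c
      head-apart c∈ with members (peeling⇒isArc (m%n<n (suc s) N) peel') c∈
      ... | t , t<m , eq = subst₂ Apart (trans (+0-% s<N) (sym b≡s)) (trans (sym (suc-% s t)) eq)
        (offsets-apart s 0 (suc t) (≤-<-trans z≤n (≤-trans (s≤s t<m) m≤n)) (≤-trans (s≤s t<m) m≤n) (λ ()))
  peeling⇒apart {s} {suc (suc m)} s<N m≤n (right {qs = qs} b≡e peel') =
    All.tabulate head-apart ∷ peeling⇒apart s<N (≤-trans (n≤1+n _) m≤n) peel'
    where
      head-apart : ∀ {c} → c ∈ qs → Apart _ c
      head-apart c∈ with members (peeling⇒isArc s<N peel') c∈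
      ... | t , t<m , eq = subst₂ Apart (sym b≡e) eq
        (offsets-apart s (suc m) t m≤n (<-trans t<m m≤n) (λ t≡m → <-irrefl (sym t≡m) t<m))

  left-right-exclusive : ∀ {s s' m b} → s < N → suc (suc m) < N → b ≡ s →
                         b ≡ (s' + suc m) % N → suc s % N ≡ s' → ⊥
  left-right-exclusive {s} {s'} {m} s<N m<N b≡s b≡e s+1≡s'
    with +-cancelˡ-% s 0 (suc (suc m)) (≤-<-trans z≤n m<N) m<N (begin
      (s + 0) % N               ≡⟨ +0-% s<N ⟩
      s                         ≡⟨ trans (sym b≡s) b≡e ⟩
      (s' + suc m) % N          ≡⟨ cong (λ z → (z + suc m) % N) s+1≡s' ⟨
      (suc s % N + suc m) % N   ≡⟨ suc-% s (suc m) ⟩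
      (s + suc (suc m)) % N     ∎)
    where open ≡-Reasoning
  ... | ()

  peeling-start-unique : ∀ {s s' m qs} → s < N → s' < N → m ≤ n →
                         Peeling s m qs → Peeling s' m qs → s ≡ s'
  peeling-start-unique _ _ _ (single b≡s) (single b≡s') = trans (sym b≡s) b≡s'
  peeling-start-unique {s} {s'} s<N s'<N m≤n (left _ p) (left _ p') =
    +-cancelˡ-% 1 s s' s<N s'<N
      (peeling-start-unique (m%n<n (suc s) N) (m%n<n (suc s') N) (≤-trans (n≤1+n _) m≤n) p p')
  peeling-start-unique s<N s'<N m≤n (right _ p) (right _ p') =
    peeling-start-unique s<N s'<N (≤-trans (n≤1+n _) m≤n) p p'
  peeling-start-unique {s} {s'} s<N s'<N m≤n (left b≡s p) (right b≡e p') =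
    ⊥-elim (left-right-exclusive s<N (≤-<-trans m≤n n<N) b≡s b≡e
      (peeling-start-unique (m%n<n (suc s) N) s'<N (≤-trans (n≤1+n _) m≤n) p p'))
  peeling-start-unique {s} {s'} s<N s'<N m≤n (right b≡e p) (left b≡s' p') =
    ⊥-elim (left-right-exclusive s'<N (≤-<-trans m≤n n<N) b≡s' b≡e
      (peeling-start-unique (m%n<n (suc s') N) s<N (≤-trans (n≤1+n _) m≤n) p' p))

  inArc⇒offset : ∀ {s ℓ p} → p < N → InArc n s ℓ p → ∃ λ t → t < ℓ × (s + t) % N ≡ p
  inArc⇒offset {s} {ℓ} {p} p<N (t , inj₁ s+t≡p) =
    toℕ t , FinP.toℕ<n t , trans (cong (_% N) s+t≡p) (m<n⇒m%n≡m p<N)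
  inArc⇒offset {s} {ℓ} {p} p<N (t , inj₂ s+t≡N+p) =
    toℕ t , FinP.toℕ<n t , (begin
      (s + toℕ t) % N  ≡⟨ cong (_% N) (trans s+t≡N+p (+-comm N p)) ⟩
      (p + N) % N      ≡⟨ [m+n]%n≡m%n p N ⟩
      p % N            ≡⟨ m<n⇒m%n≡m p<N ⟩
      p                ∎)
    where open ≡-Reasoning

  offset⇒inArc : ∀ {s ℓ p t} → s < N → t < ℓ → t < N → (s + t) % N ≡ p → InArc n s ℓ p
  offset⇒inArc {s} {ℓ} {p} {t} s<N t<ℓ t<N eq with s + t <? N
  ... | yes s+t<N = fromℕ< t<ℓ , inj₁ (begin
    s + toℕ (fromℕ< t<ℓ)  ≡⟨ cong (s +_) (FinP.toℕ-fromℕ< t<ℓ) ⟩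
    s + t                 ≡⟨ m<n⇒m%n≡m s+t<N ⟨
    (s + t) % N           ≡⟨ eq ⟩
    p                     ∎)
    where open ≡-Reasoning
  ... | no s+t≮N = fromℕ< t<ℓ , inj₂ (begin
    s + toℕ (fromℕ< t<ℓ)  ≡⟨ cong (s +_) (FinP.toℕ-fromℕ< t<ℓ) ⟩
    s + t                 ≡⟨ m∸n+n≡m N≤s+t ⟨
    (s + t ∸ N) + N       ≡⟨ cong (_+ N) (trans (sym (%-once N≤s+t (+-mono-< s<N t<N))) eq) ⟩
    p + N                 ≡⟨ +-comm p N ⟩
    N + p                 ∎)
    where
      open ≡-Reasoning
      N≤s+t : N ≤ s + t
      N≤s+t = ≮⇒≥ s+t≮N

  isArc⇒interval : ∀ {s ℓ qs} → s < N → ℓ ≤ N → IsArc s ℓ qs → IsInterval n qs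
  isArc⇒interval {s} {ℓ} {qs} s<N ℓ≤N arc = fromℕ< s<N , fromℕ< (s≤s ℓ≤N) , λ p → to p , from p
    where
      s≡ : toℕ (fromℕ< s<N) ≡ s
      s≡ = FinP.toℕ-fromℕ< s<N
      ℓ≡ : toℕ (fromℕ< (s≤s ℓ≤N)) ≡ ℓ
      ℓ≡ = FinP.toℕ-fromℕ< (s≤s ℓ≤N)

      to : (p : Fin N) → toℕ p ∈ qs → InArc n (toℕ (fromℕ< s<N)) (toℕ (fromℕ< (s≤s ℓ≤N))) (toℕ p)
      to p p∈ with members arc p∈
      ... | t , t<ℓ , eq = subst₂ (λ a b → InArc n a b (toℕ p)) (sym s≡) (sym ℓ≡)
                             (offset⇒inArc s<N t<ℓ (<-≤-trans t<ℓ ℓ≤N) eq)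

      from : (p : Fin N) → InArc n (toℕ (fromℕ< s<N)) (toℕ (fromℕ< (s≤s ℓ≤N))) (toℕ p) → toℕ p ∈ qs
      from p inArc with inArc⇒offset (FinP.toℕ<n p) (subst₂ (λ a b → InArc n a b (toℕ p)) s≡ ℓ≡ inArc)
      ... | t , t<ℓ , eq = subst (_∈ qs) eq (complete arc t t<ℓ)

  interval⇒isArc : ∀ {qs} → All (_< N) qs → IsInterval n qs → ∃ λ s → ∃ λ ℓ → IsArc s ℓ qs
  interval⇒isArc {qs} qs<N (s , ℓ , inArc⇔∈) =
    toℕ s , toℕ ℓ , record { members = mem ; complete = com }
    where
      mem : ∀ {p} → p ∈ qs → ∃ λ t → t < toℕ ℓ × (toℕ s + t) % N ≡ p
      mem {p} p∈ with inArc⇒offset {toℕ s} {toℕ ℓ} (FinP.toℕ<n (fromℕ< p<N))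
                        (proj₁ (inArc⇔∈ (fromℕ< p<N)) (subst (_∈ qs) (sym (FinP.toℕ-fromℕ< p<N)) p∈))
        where
          p<N : p < N
          p<N = All.lookup qs<N p∈
      ... | t , t<ℓ , eq = t , t<ℓ , trans eq (FinP.toℕ-fromℕ< (All.lookup qs<N p∈))

      com : ∀ t → t < toℕ ℓ → (toℕ s + t) % N ∈ qs
      com t t<ℓ = subst (_∈ qs) (FinP.toℕ-fromℕ< p<N)
        (proj₂ (inArc⇔∈ (fromℕ< p<N))
          (offset⇒inArc (FinP.toℕ<n s) t<ℓ (<-≤-trans t<ℓ (s≤s⁻¹ (FinP.toℕ<n ℓ))) (sym (FinP.toℕ-fromℕ< p<N))))
        where
          p<N : (toℕ s + t) % N < N
          p<N = m%n<n (toℕ s + t) N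

  module Extension {b s m qs S ℓ} (b<N : b < N) (s<N : s < N) (m+2≤n : suc (suc m) ≤ n)
                   (peel : Peeling s (suc m) qs) (b∉qs : b ∉ qs) (bqs : IsArc S ℓ (b ∷ qs)) where

    open ≡-Reasoning

    Extended : Set
    Extended = ∃ λ s' → s' < N × Peeling s' (suc (suc m)) (b ∷ qs)

    arc : IsArc s (suc m) qs
    arc = peeling⇒isArc s<N peel

    m+1<N : suc m < N
    m+1<N = <-trans m+2≤n n<N

    shift : ∀ t₁ → (S + t₁) % N ≡ s → ∀ k → (S + (t₁ + k)) % N ≡ (s + k) % N
    shift t₁ eq k = begin
      (S + (t₁ + k)) % N       ≡⟨ cong (_% N) (+-assoc S t₁ k) ⟨
      (S + t₁ + k) % N         ≡⟨ %-absorbˡ (S + t₁) k ⟨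
      ((S + t₁) % N + k) % N   ≡⟨ cong (λ z → (z + k) % N) eq ⟩
      (s + k) % N              ∎

    -- b lies before s in the big arc: then the point just before s is b
    extend-left : ∀ t₁ → t₁ < ℓ → (S + t₁) % N ≡ s → 0 < t₁ → Extended
    extend-left (suc t) t<ℓ eq _ with complete bqs t (<-trans (n<1+n t) t<ℓ)
    ... | here p≡b = b , b<N , left refl (subst (λ z → Peeling z (suc m) qs) (sym b+1≡s) peel)
      where
        b+1≡s : suc b % N ≡ s
        b+1≡s = begin
          suc b % N              ≡⟨ cong (λ z → suc z % N) p≡b ⟨
          suc ((S + t) % N) % N  ≡⟨ suc-%ʳ (S + t) ⟩
          suc (S + t) % N        ≡⟨ cong (_% N) (+-suc S t) ⟨
          (S + suc t) % N        ≡⟨ eq ⟩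
          s                      ∎
    ... | there p∈ with members arc p∈
    ... | t' , t'<m+1 , eq' with +-cancelˡ-% s 0 (suc t') (≤-<-trans z≤n m+1<N) (≤-<-trans t'<m+1 m+1<N) (begin
      (s + 0) % N            ≡⟨ +0-% s<N ⟩
      s                      ≡⟨ eq ⟨
      (S + suc t) % N         ≡⟨ cong (_% N) (+-suc S t) ⟩
      suc (S + t) % N         ≡⟨ suc-%ʳ (S + t) ⟨
      suc ((S + t) % N) % N   ≡⟨ cong (λ z → suc z % N) eq' ⟨
      suc ((s + t') % N) % N  ≡⟨ suc-%ʳ (s + t') ⟩
      suc (s + t') % N        ≡⟨ cong (_% N) (+-suc s t') ⟨
      (s + suc t') % N        ∎)
    ... | ()

    -- b lies after s in the big arc: then b is not inside the arc of qs, so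
    -- the point just after that arc is b
    extend-right : ∀ t₁ t₂ → t₂ < ℓ → (S + t₁) % N ≡ s → (S + t₂) % N ≡ b → t₁ < t₂ → Extended
    extend-right t₁ t₂ t₂<ℓ eq₁ eq₂ t₁<t₂ with suc (t₂ ∸ suc t₁) <? suc m
    ... | yes inside = ⊥-elim (b∉qs (subst (_∈ qs) b≡ (complete arc (suc (t₂ ∸ suc t₁)) inside)))
      where
        b≡ : (s + suc (t₂ ∸ suc t₁)) % N ≡ b
        b≡ = begin
          (s + suc (t₂ ∸ suc t₁)) % N     ≡⟨ shift t₁ eq₁ _ ⟨
          (S + (t₁ + suc (t₂ ∸ suc t₁))) % N ≡⟨ cong (λ z → (S + z) % N) (trans (+-suc t₁ _) (m+[n∸m]≡n t₁<t₂)) ⟩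
          (S + t₂) % N                    ≡⟨ eq₂ ⟩
          b                               ∎
    ... | no outside with complete bqs (t₁ + suc m) (≤-<-trans t₁+m+1≤t₂ t₂<ℓ)
      where
        t₁+m+1≤t₂ : t₁ + suc m ≤ t₂
        t₁+m+1≤t₂ = subst (t₁ + suc m ≤_) (trans (+-suc t₁ _) (m+[n∸m]≡n t₁<t₂))
                      (+-monoʳ-≤ t₁ (≮⇒≥ outside))
    ... | here p≡b = s , s<N , right (trans (sym p≡b) (shift t₁ eq₁ (suc m))) peel
    ... | there p∈ with members arc p∈
    ... | t , t<m+1 , eq = ⊥-elim (<-irrefl (+-cancelˡ-% s t (suc m) (<-trans t<m+1 m+1<N) m+1<N
                              (trans eq (shift t₁ eq₁ (suc m)))) t<m+1)

    extended : Extended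
    extended with members bqs (there (complete arc 0 (s≤s z≤n))) | members bqs (here refl)
    ... | t₁ , t₁<ℓ , eq₁ | t₂ , t₂<ℓ , eq₂ with <-cmp t₂ t₁
    ... | tri≈ _ refl _ = ⊥-elim (b∉qs (subst (_∈ qs) (trans (sym eq₁) eq₂) (complete arc 0 (s≤s z≤n))))
    ... | tri< t₂<t₁ _ _ = extend-left t₁ t₁<ℓ (trans eq₁ (+0-% s<N)) (≤-<-trans z≤n t₂<t₁)
    ... | tri> _ _ t₁<t₂ = extend-right t₁ t₂ t₂<ℓ (trans eq₁ (+0-% s<N)) eq₂ t₁<t₂

  SuffixIntervals : List ℕ → Set
  SuffixIntervals qs = ∀ k → k < length qs → IsInterval n (drop k qs)

  suffixIntervals⇒peeling : ∀ b l → All (_< N) (b ∷ l) → AllPairs _≢_ (b ∷ l) → length (b ∷ l) ≤ n →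
                            SuffixIntervals (b ∷ l) → ∃ λ s → s < N × Peeling s (length (b ∷ l)) (b ∷ l)
  suffixIntervals⇒peeling b [] (b<N ∷ _) _ _ _ = b , b<N , single refl
  suffixIntervals⇒peeling b (c ∷ l) all<N@(b<N ∷ l<N) (b∉ ∷ distinct) len≤n intervals
    with suffixIntervals⇒peeling c l l<N distinct (≤-trans (n≤1+n _) len≤n) (λ k k<len → intervals (suc k) (s≤s k<len))
       | interval⇒isArc all<N (intervals 0 (s≤s z≤n))
  ... | s , s<N , peel | S , ℓ , bqs = Extension.extended b<N s<N len≤n peel (All¬⇒¬Any b∉) bqs

  positions : ∀ {m} → Vec (Signed n) m → List ℕ
  positions v = map circlePos (toList v)

  positions-length : ∀ {m} (v : Vec (Signed n) m) → length (positions v) ≡ m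
  positions-length Vec.[]      = refl
  positions-length (a Vec.∷ v) = cong suc (positions-length v)

  circlePos<N : (a : Signed n) → circlePos a < N
  circlePos<N (neg k) = <-trans (FinP.toℕ<n k) n<N
  circlePos<N (pos k) = subst (n + toℕ k <_) n+n≡N (+-monoʳ-< n (FinP.toℕ<n k))

  positions<N : ∀ {m} (v : Vec (Signed n) m) → All (_< N) (positions v)
  positions<N Vec.[]      = []
  positions<N (a Vec.∷ v) = circlePos<N a ∷ positions<N v

  circlePos-injective : ∀ {a c : Signed n} → circlePos a ≡ circlePos c → a ≡ c
  circlePos-injective {neg k} {neg k'} eq = cong neg (FinP.toℕ-injective eq)
  circlePos-injective {neg k} {pos k'} eq = ⊥-elim (<⇒≱ (FinP.toℕ<n k) (subst (n ≤_) (sym eq) (m≤m+n n _)))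
  circlePos-injective {pos k} {neg k'} eq = ⊥-elim (<⇒≱ (FinP.toℕ<n k') (subst (n ≤_) eq (m≤m+n n _)))
  circlePos-injective {pos k} {pos k'} eq = cong pos (FinP.toℕ-injective (+-cancelˡ-≡ n _ _ eq))

  apart⇒abs≢ : ∀ (a c : Signed n) → Apart (circlePos a) (circlePos c) → ∣ a ∣ˢ ≢ ∣ c ∣ˢ
  apart⇒abs≢ (neg k) (neg k') (a≢c , _ , _) eq = a≢c (cong toℕ eq)
  apart⇒abs≢ (neg k) (pos k') (_ , a+n≢c , _) eq = a+n≢c (trans (+-comm (toℕ k) n) (cong (λ i → n + toℕ i) eq))
  apart⇒abs≢ (pos k) (neg k') (_ , _ , c+n≢a) eq = c+n≢a (trans (+-comm (toℕ k') n) (cong (λ i → n + toℕ i) (sym eq)))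
  apart⇒abs≢ (pos k) (pos k') (a≢c , _ , _) eq = a≢c (cong (λ i → n + toℕ i) eq)

  positions-lookup : ∀ {m} (v : Vec (Signed n) m) j → circlePos (lookup v j) ∈ positions v
  positions-lookup (a Vec.∷ v) Fin.zero    = here refl
  positions-lookup (a Vec.∷ v) (Fin.suc j) = there (positions-lookup v j)

  positions-member : ∀ {m} (v : Vec (Signed n) m) {p} → p ∈ positions v → ∃ λ j → circlePos (lookup v j) ≡ p
  positions-member (a Vec.∷ v) (here p≡a) = Fin.zero , sym p≡a
  positions-member (a Vec.∷ v) (there p∈) with positions-member v p∈
  ... | j , eq = Fin.suc j , eq

  AbsDistinctᵥ : ∀ {m} → Vec (Signed n) m → Set
  AbsDistinctᵥ {m} v = (i j : Fin m) → ∣ lookup v i ∣ˢ ≡ ∣ lookup v j ∣ˢ → i ≡ j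

  absDistinct⇒distinct : ∀ {m} (v : Vec (Signed n) m) → AbsDistinctᵥ v → AllPairs _≢_ (positions v)
  absDistinct⇒distinct Vec.[]      _    = []
  absDistinct⇒distinct (a Vec.∷ v) dist =
    All.tabulate head-new ∷ absDistinct⇒distinct v (λ i j eq → FinP.suc-injective (dist (Fin.suc i) (Fin.suc j) eq))
    where
      head-new : ∀ {p} → p ∈ positions v → circlePos a ≢ p
      head-new p∈ a≡p with positions-member v p∈
      ... | j , eq with dist (Fin.suc j) Fin.zero (cong ∣_∣ˢ (circlePos-injective {lookup v j} {a} (trans eq (sym a≡p))))
      ... | ()

  apart⇒absDistinct : ∀ {m} (v : Vec (Signed n) m) → AllPairs Apart (positions v) → AbsDistinctᵥ v
  apart⇒absDistinct (a Vec.∷ v) (h ∷ hs) Fin.zero    Fin.zero    _  = refl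
  apart⇒absDistinct (a Vec.∷ v) (h ∷ hs) Fin.zero    (Fin.suc j) eq =
    ⊥-elim (apart⇒abs≢ a (lookup v j) (All.lookup h (positions-lookup v j)) eq)
  apart⇒absDistinct (a Vec.∷ v) (h ∷ hs) (Fin.suc i) Fin.zero    eq =
    ⊥-elim (apart⇒abs≢ a (lookup v i) (All.lookup h (positions-lookup v i)) (sym eq))
  apart⇒absDistinct (a Vec.∷ v) (h ∷ hs) (Fin.suc i) (Fin.suc j) eq = cong Fin.suc (apart⇒absDistinct v hs i j eq)

  bArc⇒suffixIntervals : (w : Word n) → IsBArc w → SuffixIntervals (positions w)
  bArc⇒suffixIntervals w bArc k k<len =
    subst (IsInterval n) (sym (drop-map k (toList w)))
      (subst (λ z → IsInterval n (map circlePos (drop z (toList w)))) (FinP.toℕ-fromℕ< k<n) (bArc (fromℕ< k<n)))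
    where
      k<n : k < n
      k<n = subst (k <_) (positions-length w) k<len

  peeling⇒bArc : (w : Word n) → ∀ {s} → s < N → Peeling s n (positions w) → IsBArc w
  peeling⇒bArc w s<N peel k with peeling-drop s<N peel (toℕ k) (FinP.toℕ<n k)
  ... | s' , s'<N , peel' = subst (IsInterval n) (drop-map (toℕ k) (toList w))
                              (isArc⇒interval s'<N (≤-trans (m∸n≤m n (toℕ k)) (<⇒≤ n<N)) (peeling⇒isArc s'<N peel'))

  bArc⇒peeling : (w : Word n) → AbsDistinct w → IsBArc w → ∃ λ s → s < N × Peeling s n (positions w)
  bArc⇒peeling w@(a Vec.∷ v) dist bArc
    with suffixIntervals⇒peeling (circlePos a) (positions v) (positions<N w) (absDistinct⇒distinct w dist)
           (≤-reflexive (positions-length w)) (bArc⇒suffixIntervals w bArc)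
  ... | s , s<N , peel = s , s<N , subst (λ z → Peeling s z (positions w)) (positions-length w) peel

  arcCount : Word n → ℕ
  arcCount w = sumBelow N (λ s → peelings s n (positions w))

  no-peeling⇒peelings≡0 : ∀ (w : Word n) s → ¬ Peeling s n (positions w) → peelings s n (positions w) ≡ 0
  no-peeling⇒peelings≡0 w s ¬peel with peelings s n (positions w) ≟ 0
  ... | yes eq = eq
  ... | no neq = ⊥-elim (¬peel (peelings≢0⇒peeling s n (positions w) neq))

  arcCount-decided : ∀ w (dist? : Dec (AbsDistinct w)) (bArc? : Dec (IsBArc w)) →
                     arcCount w ≡ (if does dist? then (if does bArc? then 1 else 0) else 0)
  arcCount-decided w (yes dist) (yes bArc) with bArc⇒peeling w dist bArc
  ... | s₀ , s₀<N , peel₀ = sumBelow-single N _ s₀ s₀<N (peeling⇒peelings≡1 s₀<N ≤-refl peel₀)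
    (λ s s<N s≢s₀ → no-peeling⇒peelings≡0 w s (λ peel → s≢s₀ (peeling-start-unique s<N s₀<N ≤-refl peel peel₀)))
  arcCount-decided w (yes _) (no ¬bArc) =
    sumBelow-zero N _ (λ s s<N → no-peeling⇒peelings≡0 w s (λ peel → ¬bArc (peeling⇒bArc w s<N peel)))
  arcCount-decided w (no ¬dist) _ =
    sumBelow-zero N _ (λ s s<N → no-peeling⇒peelings≡0 w s
      (λ peel → ¬dist (apart⇒absDistinct w (peeling⇒apart s<N ≤-refl peel))))

  arcCount-indicator : ∀ w → arcCount w ≡ (if does (absDistinct? w) then (if does (isBArc? w) then 1 else 0) else 0)
  arcCount-indicator w = arcCount-decided w (absDistinct? w) (isBArc? w)

  -- Wrapped arcs consist of a top part N-k-1, …, N-1 (k+1 points) and a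
  -- bottom part 0, …, r (r+1 points); the arc starts at top k.
  top : ℕ → ℕ
  top k = N ∸ suc k

  top+suc : ∀ k → suc k ≤ N → top k + suc k ≡ N
  top+suc k = m∸n+n≡m

  top+length : ∀ k r → suc (suc (k + r)) < N → (top k + suc (k + r)) % N ≡ r
  top+length k r bound = begin
    (top k + (suc k + r)) % N   ≡⟨ cong (_% N) (sym (+-assoc (top k) (suc k) r)) ⟩
    (top k + suc k + r) % N     ≡⟨ cong (λ z → (z + r) % N) (top+suc k k<N) ⟩
    (N + r) % N                 ≡⟨ cong (_% N) (+-comm N r) ⟩
    (r + N) % N                 ≡⟨ [m+n]%n≡m%n r N ⟩
    r % N                       ≡⟨ m<n⇒m%n≡m r<N ⟩
    r                           ∎
    where
      open ≡-Reasoning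
      k<N : suc k ≤ N
      k<N = ≤-trans (s≤s (m≤m+n k r)) (<⇒≤ (<-trans (n<1+n _) bound))
      r<N : r < N
      r<N = ≤-<-trans (m≤n+m r (suc k)) (<-trans (n<1+n _) bound)

  suc-top : ∀ k → suc (suc k) ≤ N → suc (top (suc k)) ≡ top k
  suc-top k le = sym (+-∸-assoc 1 le)

  top-of-start : ∀ t k → suc n + t + suc k ≡ N → top k ≡ suc n + t
  top-of-start t k eq = trans (cong (_∸ suc k) (sym eq)) (m+n∸n≡m (suc n + t) (suc k))

module Sums {c ℓ : Level} (R : CommutativeRing c ℓ) where

  open CommutativeRing R renaming (_+_ to _+ᴿ_; _*_ to _*ᴿ_)
  open RingOps R using (Σᴿ; natᴿ)
  open SemiringMult semiring using (×-homo-+; ×1-homo-*) renaming (_×_ to _×ᴿ_)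
  open CommSemigroupProps +-commutativeSemigroup using () renaming (interchange to +-interchange)
  open SetoidReasoning setoid

  Σᴿ-cong : ∀ {A : Set} {f g : A → Carrier} (L : List A) → (∀ a → f a ≈ g a) →
            Σᴿ (map f L) ≈ Σᴿ (map g L)
  Σᴿ-cong []      h = refl
  Σᴿ-cong (a ∷ L) h = +-cong (h a) (Σᴿ-cong L h)

  Σᴿ-+ : ∀ {A : Set} (f g : A → Carrier) L →
         Σᴿ (map (λ a → f a +ᴿ g a) L) ≈ Σᴿ (map f L) +ᴿ Σᴿ (map g L)
  Σᴿ-+ f g []      = sym (+-identityʳ 0#)
  Σᴿ-+ f g (a ∷ L) = trans (+-congˡ (Σᴿ-+ f g L)) (+-interchange (f a) (g a) _ _)

  Σᴿ-*ˡ : ∀ {A : Set} (k : Carrier) (f : A → Carrier) L →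
          Σᴿ (map (λ a → k *ᴿ f a) L) ≈ k *ᴿ Σᴿ (map f L)
  Σᴿ-*ˡ k f []      = sym (zeroʳ k)
  Σᴿ-*ˡ k f (a ∷ L) = trans (+-congˡ (Σᴿ-*ˡ k f L)) (sym (distribˡ k (f a) _))

  Σᴿ-++ : ∀ {A : Set} (f : A → Carrier) L₁ L₂ →
          Σᴿ (map f (L₁ ++ L₂)) ≈ Σᴿ (map f L₁) +ᴿ Σᴿ (map f L₂)
  Σᴿ-++ f []       L₂ = sym (+-identityˡ _)
  Σᴿ-++ f (a ∷ L₁) L₂ = trans (+-congˡ (Σᴿ-++ f L₁ L₂)) (sym (+-assoc (f a) _ _))

  Σᴿ-concatMap : ∀ {A B : Set} (f : B → Carrier) (g : A → List B) L →
                 Σᴿ (map f (concatMap g L)) ≈ Σᴿ (map (λ a → Σᴿ (map f (g a))) L)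
  Σᴿ-concatMap f g []      = refl
  Σᴿ-concatMap f g (a ∷ L) = trans (Σᴿ-++ f (g a) (concatMap g L)) (+-congˡ (Σᴿ-concatMap f g L))

  Σᴿ-map : ∀ {A B : Set} (f : B → Carrier) (h : A → B) L →
           Σᴿ (map f (map h L)) ≡ Σᴿ (map (λ a → f (h a)) L)
  Σᴿ-map f h L = ≡.cong Σᴿ (≡.sym (map-∘ L))

  Σᴿ-filter : ∀ {A : Set} {Q : A → Set} (Q? : Decidable Q) (f : A → Carrier) L →
              Σᴿ (map f (filter Q? L)) ≈ Σᴿ (map (λ a → if does (Q? a) then f a else 0#) L)
  Σᴿ-filter Q? f []      = refl
  Σᴿ-filter Q? f (a ∷ L) with does (Q? a)
  ... | true  = +-congˡ (Σᴿ-filter Q? f L)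
  ... | false = trans (Σᴿ-filter Q? f L) (sym (+-identityˡ _))

  natᴿ≡×1 : ∀ m → natᴿ m ≡ m ×ᴿ 1#
  natᴿ≡×1 zero    = ≡.refl
  natᴿ≡×1 (suc m) = ≡.cong (1# +ᴿ_) (natᴿ≡×1 m)

  natᴿ-+ : ∀ a b → natᴿ (a + b) ≈ natᴿ a +ᴿ natᴿ b
  natᴿ-+ a b = begin
    natᴿ (a + b)             ≡⟨ natᴿ≡×1 (a + b) ⟩
    (a + b) ×ᴿ 1#            ≈⟨ ×-homo-+ 1# a b ⟩
    a ×ᴿ 1# +ᴿ b ×ᴿ 1#       ≡⟨ ≡.cong₂ _+ᴿ_ (natᴿ≡×1 a) (natᴿ≡×1 b) ⟨
    natᴿ a +ᴿ natᴿ b         ∎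

  natᴿ-* : ∀ a b → natᴿ (a * b) ≈ natᴿ a *ᴿ natᴿ b
  natᴿ-* a b = begin
    natᴿ (a * b)             ≡⟨ natᴿ≡×1 (a * b) ⟩
    (a * b) ×ᴿ 1#            ≈⟨ ×1-homo-* a b ⟩
    (a ×ᴿ 1#) *ᴿ (b ×ᴿ 1#)   ≡⟨ ≡.cong₂ _*ᴿ_ (natᴿ≡×1 a) (natᴿ≡×1 b) ⟨
    natᴿ a *ᴿ natᴿ b         ∎

  natᴿ-1 : natᴿ 1 ≈ 1#
  natᴿ-1 = +-identityʳ 1#

  Σ< : ℕ → (ℕ → Carrier) → Carrier
  Σ< zero    f = 0#
  Σ< (suc k) f = f 0 +ᴿ Σ< k (λ t → f (suc t))

  Σ<-cong : ∀ k {f g : ℕ → Carrier} → (∀ s → s < k → f s ≈ g s) → Σ< k f ≈ Σ< k g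
  Σ<-cong zero    h = refl
  Σ<-cong (suc k) h = +-cong (h 0 (s≤s z≤n)) (Σ<-cong k (λ s s<k → h (suc s) (s≤s s<k)))

  Σ<-zero : ∀ k {f : ℕ → Carrier} → (∀ s → s < k → f s ≈ 0#) → Σ< k f ≈ 0#
  Σ<-zero zero    h = refl
  Σ<-zero (suc k) h = trans (+-cong (h 0 (s≤s z≤n)) (Σ<-zero k (λ s s<k → h (suc s) (s≤s s<k)))) (+-identityʳ 0#)

  Σ<-single : ∀ k t {f : ℕ → Carrier} → t < k → (∀ s → s < k → s ≢ t → f s ≈ 0#) → Σ< k f ≈ f t
  Σ<-single (suc k) zero    _ h = trans (+-congˡ (Σ<-zero k (λ s s<k → h (suc s) (s≤s s<k) (λ ())))) (+-identityʳ _)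
  Σ<-single (suc k) (suc t) {f} (s≤s t<k) h = begin
    f 0 +ᴿ Σ< k (λ s → f (suc s))
      ≈⟨ +-cong (h 0 (s≤s z≤n) (λ ()))
                (Σ<-single k t t<k (λ s s<k s≢t → h (suc s) (s≤s s<k) (s≢t ∘ ℕP.suc-injective))) ⟩
    0# +ᴿ f (suc t)
      ≈⟨ +-identityˡ _ ⟩
    f (suc t) ∎

  Σ<-+ : ∀ k (f g : ℕ → Carrier) → Σ< k (λ s → f s +ᴿ g s) ≈ Σ< k f +ᴿ Σ< k g
  Σ<-+ zero    f g = sym (+-identityʳ 0#)
  Σ<-+ (suc k) f g = trans (+-congˡ (Σ<-+ k _ _)) (+-interchange (f 0) (g 0) _ _)

  Σ<-*ʳ : ∀ k (f : ℕ → Carrier) y → Σ< k f *ᴿ y ≈ Σ< k (λ s → f s *ᴿ y)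
  Σ<-*ʳ zero    f y = zeroˡ y
  Σ<-*ʳ (suc k) f y = trans (distribʳ y (f 0) _) (+-congˡ (Σ<-*ʳ k _ y))

  Σ<-const : ∀ k y → Σ< k (λ _ → y) ≈ natᴿ k *ᴿ y
  Σ<-const zero    y = sym (zeroˡ y)
  Σ<-const (suc k) y = begin
    y +ᴿ Σ< k (λ _ → y)         ≈⟨ +-cong (sym (*-identityˡ y)) (Σ<-const k y) ⟩
    1# *ᴿ y +ᴿ natᴿ k *ᴿ y      ≈⟨ distribʳ y 1# (natᴿ k) ⟨
    (1# +ᴿ natᴿ k) *ᴿ y         ∎

  Σ<-split : ∀ a b (f : ℕ → Carrier) → Σ< (a + b) f ≈ Σ< a f +ᴿ Σ< b (λ t → f (a + t))
  Σ<-split zero    b f = sym (+-identityˡ _)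
  Σ<-split (suc a) b f = trans (+-congˡ (Σ<-split a b (λ t → f (suc t)))) (sym (+-assoc (f 0) _ _))

  Σᴿ-tabulate : ∀ m (f : ℕ → Carrier) → Σᴿ (tabulate {n = m} (λ k → f (toℕ k))) ≡ Σ< m f
  Σᴿ-tabulate zero    f = ≡.refl
  Σᴿ-tabulate (suc m) f = ≡.cong (f 0 +ᴿ_) (Σᴿ-tabulate m (λ t → f (suc t)))

  natᴿ-sumBelow : ∀ k (g : ℕ → ℕ) → natᴿ (sumBelow k g) ≈ Σ< k (λ s → natᴿ (g s))
  natᴿ-sumBelow zero    g = refl
  natᴿ-sumBelow (suc k) g = trans (natᴿ-+ (g 0) _) (+-congˡ (natᴿ-sumBelow k _))

  Σᴿ-Σ<-swap : ∀ {A : Set} (L : List A) k (H : ℕ → A → Carrier) →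
               Σᴿ (map (λ a → Σ< k (λ s → H s a)) L) ≈ Σ< k (λ s → Σᴿ (map (H s) L))
  Σᴿ-Σ<-swap []      k H = sym (Σ<-zero k (λ _ _ → refl))
  Σᴿ-Σ<-swap (a ∷ L) k H = trans (+-congˡ (Σᴿ-Σ<-swap L k H)) (sym (Σ<-+ k _ _))

  antidiag : (ℕ → ℕ → Carrier) → ℕ → ℕ → Carrier
  antidiag g zero    r = g 0 r
  antidiag g (suc k) r = g (suc k) r +ᴿ antidiag g k (suc r)

  antidiag≈Σ< : ∀ g k r → antidiag g k r ≈ Σ< (suc k) (λ t → g (k ∸ t) (r + t))
  antidiag≈Σ< g zero    r = trans (reflexive (≡.cong (g 0) (≡.sym (ℕP.+-identityʳ r)))) (sym (+-identityʳ _))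
  antidiag≈Σ< g (suc k) r = +-cong (reflexive (≡.cong (g (suc k)) (≡.sym (ℕP.+-identityʳ r))))
    (trans (antidiag≈Σ< g k (suc r)) (Σ<-cong (suc k) (λ t _ → reflexive (≡.cong (g (k ∸ t)) (≡.sym (ℕP.+-suc r t))))))

  antidiag-+ : ∀ (f g : ℕ → ℕ → Carrier) k r → antidiag (λ a b → f a b +ᴿ g a b) k r ≈ antidiag f k r +ᴿ antidiag g k r
  antidiag-+ f g zero    r = refl
  antidiag-+ f g (suc k) r = trans (+-congˡ (antidiag-+ f g k (suc r))) (+-interchange (f (suc k) r) (g (suc k) r) _ _)

  antidiag-*ˡ : ∀ y (f : ℕ → ℕ → Carrier) k r → antidiag (λ a b → y *ᴿ f a b) k r ≈ y *ᴿ antidiag f k r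
  antidiag-*ˡ y f zero    r = refl
  antidiag-*ˡ y f (suc k) r = trans (+-congˡ (antidiag-*ˡ y f k (suc r))) (sym (distribˡ y (f (suc k) r) _))

module Transfer {c ℓ : Level} (R : CommutativeRing c ℓ) (n₀ : ℕ) (x : ℕ → CommutativeRing.Carrier R) where

  open Peelings n₀
  open CommutativeRing R renaming (_+_ to _+ᴿ_; _*_ to _*ᴿ_)
  open RingOps R using (Σᴿ; natᴿ; xPow; lhs)
  open Sums R
  open NatCoeffSolver commutativeSemiring using (solve; _:+_; _:*_; _:=_)
  open SetoidReasoning setoid

  descentWeight : ℕ → ℕ → ℕ → Carrier
  descentWeight i a b = if does (b <? a) then x i else 1#

  descents : ℕ → ℕ → List ℕ → List ℕ
  descents i a []       = []
  descents i a (b ∷ ps) = if does (b <? a) then i ∷ descents (suc i) b ps else descents (suc i) b ps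

  xPow-descents : ∀ i a b ps → xPow x (descents i a (b ∷ ps)) ≈ descentWeight i a b *ᴿ xPow x (descents (suc i) b ps)
  xPow-descents i a b ps with does (b <? a)
  ... | true  = refl
  ... | false = sym (*-identityˡ _)

  -- Positions are ranks, so Des is computed on positions; the sentinel 0 in
  -- front of the word never creates a descent and shifts indices to 1, 2, ….
  rank≡circlePos : (a : Signed n) → rank a ≡ circlePos a
  rank≡circlePos (neg k) = ≡.refl
  rank≡circlePos (pos k) = ≡.refl

  desAfter≡descents : ∀ i (a : Signed n) l → desAfter i a l ≡ descents i (circlePos a) (map circlePos l)
  desAfter≡descents i a []      = ≡.refl
  desAfter≡descents i a (b ∷ l) rewrite rank≡circlePos a | rank≡circlePos b | desAfter≡descents (suc i) b l = ≡.refl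

  Des≡descents : (w : Word n) → Des w ≡ descents 0 0 (positions w)
  Des≡descents (a Vec.∷ v) = desAfter≡descents 1 a (toList v)

  -- arcWeight a i s m: the sum of x^D over the words v of length m whose
  -- positions peel the arc (s, m), where D is the descent set of a ∷ v and
  -- a has index i (this is the content of `transfer` below)
  arcWeight : ℕ → ℕ → ℕ → ℕ → Carrier
  arcWeight a i s zero          = 1#
  arcWeight a i s 1             = descentWeight i a s
  arcWeight a i s (suc (suc m)) =
    descentWeight i a s *ᴿ arcWeight s (suc i) (suc s % N) (suc m) +ᴿ
    descentWeight i a ((s + suc m) % N) *ᴿ arcWeight ((s + suc m) % N) (suc i) s (suc m)

  Σ-letters : (f : ℕ → Carrier) → Σᴿ (map (λ b → f (circlePos b)) (allSigned n)) ≈ Σ< N f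
  Σ-letters f = begin
    Σᴿ (map F (map neg (allFin n) ++ map pos (allFin n)))
      ≈⟨ Σᴿ-++ F (map neg (allFin n)) (map pos (allFin n)) ⟩
    Σᴿ (map F (map neg (allFin n))) +ᴿ Σᴿ (map F (map pos (allFin n)))
      ≡⟨ ≡.cong₂ _+ᴿ_ (≡.trans (half neg) (Σᴿ-tabulate n f)) (≡.trans (half pos) (Σᴿ-tabulate n (λ t → f (n + t)))) ⟩
    Σ< n f +ᴿ Σ< n (λ t → f (n + t))
      ≈⟨ Σ<-split n n f ⟨
    Σ< (n + n) f
      ≡⟨ ≡.cong (λ k → Σ< k f) n+n≡N ⟩
    Σ< N f ∎
    where
      F : Signed n → Carrier
      F b = f (circlePos b)
      half : (sign : Fin n → Signed n) → Σᴿ (map F (map sign (allFin n))) ≡ Σᴿ (tabulate {n = n} (λ k → F (sign k)))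
      half sign = ≡.trans (Σᴿ-map F sign (allFin n)) (≡.cong Σᴿ (map-tabulate (λ k → k) (λ k → F (sign k))))

  Σ-words : ∀ m (F : Vec (Signed n) (suc m) → Carrier) (G : ℕ → Vec (Signed n) m → Carrier) →
            (∀ b v → F (b Vec.∷ v) ≈ G (circlePos b) v) →
            Σᴿ (map F (allWords (allSigned n) (suc m))) ≈ Σ< N (λ p → Σᴿ (map (G p) (allWords (allSigned n) m)))
  Σ-words m F G F≈G = begin
    Σᴿ (map F (concatMap (λ b → map (b Vec.∷_) W) (allSigned n)))
      ≈⟨ Σᴿ-concatMap F (λ b → map (b Vec.∷_) W) (allSigned n) ⟩
    Σᴿ (map (λ b → Σᴿ (map F (map (b Vec.∷_) W))) (allSigned n))
      ≈⟨ Σᴿ-cong (allSigned n) first-letter ⟩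
    Σᴿ (map (λ b → Σᴿ (map (G (circlePos b)) W)) (allSigned n))
      ≈⟨ Σ-letters (λ p → Σᴿ (map (G p) W)) ⟩
    Σ< N (λ p → Σᴿ (map (G p) W)) ∎
    where
      W : List (Vec (Signed n) m)
      W = allWords (allSigned n) m
      first-letter : ∀ b → Σᴿ (map F (map (b Vec.∷_) W)) ≈ Σᴿ (map (G (circlePos b)) W)
      first-letter b = trans (reflexive (Σᴿ-map F (b Vec.∷_) W)) (Σᴿ-cong W (F≈G b))

  Σ<-δ : ∀ t (h : ℕ → Carrier) → t < N → Σ< N (λ p → natᴿ (δ p t) *ᴿ h p) ≈ h t
  Σ<-δ t h t<N = begin
    Σ< N (λ p → natᴿ (δ p t) *ᴿ h p)  ≈⟨ Σ<-single N t t<N vanish ⟩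
    natᴿ (δ t t) *ᴿ h t               ≡⟨ ≡.cong (λ k → natᴿ k *ᴿ h t) (δ-≡ {t} {t} ≡.refl) ⟩
    natᴿ 1 *ᴿ h t                     ≈⟨ *-congʳ natᴿ-1 ⟩
    1# *ᴿ h t                         ≈⟨ *-identityˡ (h t) ⟩
    h t                               ∎
    where
      vanish : ∀ p → p < N → p ≢ t → natᴿ (δ p t) *ᴿ h p ≈ 0#
      vanish p _ p≢t = trans (*-congʳ (reflexive (≡.cong natᴿ (δ-≢ p≢t)))) (zeroˡ (h p))

  weightedPeelings : ℕ → ℕ → ℕ → (m : ℕ) → Vec (Signed n) m → Carrier
  weightedPeelings a i s m v = natᴿ (peelings s m (positions v)) *ᴿ xPow x (descents i a (positions v))

  weightedPeelings-cons : ∀ a i s m b v → let p = circlePos b ; e = (s + suc m) % N in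
    weightedPeelings a i s (suc (suc m)) (b Vec.∷ v) ≈
      natᴿ (δ p s) *ᴿ (descentWeight i a p *ᴿ weightedPeelings p (suc i) (suc s % N) (suc m) v) +ᴿ
      natᴿ (δ p e) *ᴿ (descentWeight i a p *ᴿ weightedPeelings p (suc i) s (suc m) v)
  weightedPeelings-cons a i s m b v = begin
    natᴿ (δ p s * P₁ + δ p e * P₂) *ᴿ xPow x (descents i a (p ∷ positions v))
      ≈⟨ *-cong (trans (natᴿ-+ (δ p s * P₁) (δ p e * P₂)) (+-cong (natᴿ-* (δ p s) P₁) (natᴿ-* (δ p e) P₂)))
                (xPow-descents i a p (positions v)) ⟩
    (natᴿ (δ p s) *ᴿ natᴿ P₁ +ᴿ natᴿ (δ p e) *ᴿ natᴿ P₂) *ᴿ (descentWeight i a p *ᴿ X)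
      ≈⟨ solve 6 (λ d₁ q₁ d₂ q₂ w y → (d₁ :* q₁ :+ d₂ :* q₂) :* (w :* y) :=
                                       d₁ :* (w :* (q₁ :* y)) :+ d₂ :* (w :* (q₂ :* y)))
               refl (natᴿ (δ p s)) (natᴿ P₁) (natᴿ (δ p e)) (natᴿ P₂) (descentWeight i a p) X ⟩
    natᴿ (δ p s) *ᴿ (descentWeight i a p *ᴿ (natᴿ P₁ *ᴿ X)) +ᴿ
    natᴿ (δ p e) *ᴿ (descentWeight i a p *ᴿ (natᴿ P₂ *ᴿ X)) ∎
    where
      p e P₁ P₂ : ℕ
      p = circlePos b
      e = (s + suc m) % N
      P₁ = peelings (suc s % N) (suc m) (positions v)
      P₂ = peelings s (suc m) (positions v)
      X : Carrier
      X = xPow x (descents (suc i) p (positions v))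

  transfer : ∀ m a i s → s < N →
             Σᴿ (map (weightedPeelings a i s (suc m)) (allWords (allSigned n) (suc m))) ≈ arcWeight a i s (suc m)
  transfer zero a i s s<N = begin
    Σᴿ (map (weightedPeelings a i s 1) (allWords (allSigned n) 1))
      ≈⟨ Σ-words 0 (weightedPeelings a i s 1) (λ p _ → natᴿ (δ p s) *ᴿ descentWeight i a p) single-letter ⟩
    Σ< N (λ p → natᴿ (δ p s) *ᴿ descentWeight i a p +ᴿ 0#)
      ≈⟨ Σ<-cong N (λ p _ → +-identityʳ (natᴿ (δ p s) *ᴿ descentWeight i a p)) ⟩
    Σ< N (λ p → natᴿ (δ p s) *ᴿ descentWeight i a p)
      ≈⟨ Σ<-δ s (descentWeight i a) s<N ⟩
    descentWeight i a s ∎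
    where
      single-letter : ∀ b v → weightedPeelings a i s 1 (b Vec.∷ v) ≈
                              natᴿ (δ (circlePos b) s) *ᴿ descentWeight i a (circlePos b)
      single-letter b Vec.[] = *-congˡ (trans (xPow-descents i a (circlePos b) []) (*-identityʳ _))
  transfer (suc m) a i s s<N = begin
    Σᴿ (map (weightedPeelings a i s (suc (suc m))) (allWords (allSigned n) (suc (suc m))))
      ≈⟨ Σ-words (suc m) (weightedPeelings a i s (suc (suc m))) G (weightedPeelings-cons a i s m) ⟩
    Σ< N (λ p → Σᴿ (map (G p) W))
      ≈⟨ Σ<-cong N (λ p _ → trans (Σᴿ-+ (G₁ p) (G₂ p) W)
                                  (+-cong (inner p (suc s % N) s (m%n<n (suc s) N)) (inner p s e s<N))) ⟩
    Σ< N (λ p → natᴿ (δ p s) *ᴿ h₁ p +ᴿ natᴿ (δ p e) *ᴿ h₂ p)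
      ≈⟨ Σ<-+ N (λ p → natᴿ (δ p s) *ᴿ h₁ p) (λ p → natᴿ (δ p e) *ᴿ h₂ p) ⟩
    Σ< N (λ p → natᴿ (δ p s) *ᴿ h₁ p) +ᴿ Σ< N (λ p → natᴿ (δ p e) *ᴿ h₂ p)
      ≈⟨ +-cong (Σ<-δ s h₁ s<N) (Σ<-δ e h₂ (m%n<n (s + suc m) N)) ⟩
    arcWeight a i s (suc (suc m)) ∎
    where
      W : List (Vec (Signed n) (suc m))
      W = allWords (allSigned n) (suc m)
      e : ℕ
      e = (s + suc m) % N
      G₁ G₂ G : ℕ → Vec (Signed n) (suc m) → Carrier
      G₁ p v = natᴿ (δ p s) *ᴿ (descentWeight i a p *ᴿ weightedPeelings p (suc i) (suc s % N) (suc m) v)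
      G₂ p v = natᴿ (δ p e) *ᴿ (descentWeight i a p *ᴿ weightedPeelings p (suc i) s (suc m) v)
      G p v = G₁ p v +ᴿ G₂ p v
      h₁ h₂ : ℕ → Carrier
      h₁ p = descentWeight i a p *ᴿ arcWeight p (suc i) (suc s % N) (suc m)
      h₂ p = descentWeight i a p *ᴿ arcWeight p (suc i) s (suc m)
      inner : ∀ p s' (t : ℕ) → s' < N →
              Σᴿ (map (λ v → natᴿ (δ p t) *ᴿ (descentWeight i a p *ᴿ weightedPeelings p (suc i) s' (suc m) v)) W) ≈
              natᴿ (δ p t) *ᴿ (descentWeight i a p *ᴿ arcWeight p (suc i) s' (suc m))
      inner p s' t s'<N = trans (Σᴿ-*ˡ _ _ W) (*-congˡ (trans (Σᴿ-*ˡ _ _ W) (*-congˡ (transfer m p (suc i) s' s'<N))))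

  if-if≈natᴿ : ∀ (b₁ b₂ : Bool) y →
               (if b₁ then (if b₂ then y else 0#) else 0#) ≈ natᴿ (if b₁ then (if b₂ then 1 else 0) else 0) *ᴿ y
  if-if≈natᴿ true  true  y = sym (trans (*-congʳ natᴿ-1) (*-identityˡ y))
  if-if≈natᴿ true  false y = sym (zeroˡ y)
  if-if≈natᴿ false b₂    y = sym (zeroˡ y)

  -- the definition of the left-hand side, stated for an arbitrary number of
  -- letters so that checking it does not evaluate the filters
  lhs-unfold : ∀ m → lhs m x ≡ Σᴿ (map (λ w → xPow x (Des w)) (filter isBArc? (filter absDistinct? (allWords (allSigned m) m))))
  lhs-unfold m = ≡.refl

  lhs≈Σ-arcWeight : lhs n x ≈ Σ< N (λ s → arcWeight 0 0 s n)
  lhs≈Σ-arcWeight = begin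
    lhs n x
      ≡⟨ lhs-unfold n ⟩
    Σᴿ (map f (filter isBArc? (filter absDistinct? W)))
      ≈⟨ Σᴿ-filter isBArc? f (filter absDistinct? W) ⟩
    Σᴿ (map (λ w → if does (isBArc? w) then f w else 0#) (filter absDistinct? W))
      ≈⟨ Σᴿ-filter absDistinct? (λ w → if does (isBArc? w) then f w else 0#) W ⟩
    Σᴿ (map (λ w → if does (absDistinct? w) then (if does (isBArc? w) then f w else 0#) else 0#) W)
      ≈⟨ Σᴿ-cong W (λ w → trans (if-if≈natᴿ (does (absDistinct? w)) (does (isBArc? w)) (f w))
                                 (*-congʳ (reflexive (≡.cong natᴿ (≡.sym (arcCount-indicator w)))))) ⟩
    Σᴿ (map (λ w → natᴿ (arcCount w) *ᴿ f w) W)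
      ≈⟨ Σᴿ-cong W (λ w → trans (*-congʳ (natᴿ-sumBelow N (λ s → peelings s n (positions w))))
                                 (Σ<-*ʳ N (λ s → natᴿ (peelings s n (positions w))) (f w))) ⟩
    Σᴿ (map (λ w → Σ< N (λ s → natᴿ (peelings s n (positions w)) *ᴿ f w)) W)
      ≈⟨ Σᴿ-Σ<-swap W N (λ s w → natᴿ (peelings s n (positions w)) *ᴿ f w) ⟩
    Σ< N (λ s → Σᴿ (map (λ w → natᴿ (peelings s n (positions w)) *ᴿ f w) W))
      ≈⟨ Σ<-cong N (λ s s<N → trans (Σᴿ-cong W (λ w → *-congˡ (reflexive (≡.cong (xPow x) (Des≡descents w)))))
                                    (transfer n₀ 0 0 s s<N)) ⟩
    Σ< N (λ s → arcWeight 0 0 s n) ∎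
    where
      W : List (Word n)
      W = allWords (allSigned n) n
      f : Word n → Carrier
      f w = xPow x (Des w)

module Evaluation {c ℓ : Level} (R : CommutativeRing c ℓ) (n' : ℕ) (x : ℕ → CommutativeRing.Carrier R) where

  open Peelings (suc n')
  open Transfer R (suc n') x
  open CommutativeRing R renaming (_+_ to _+ᴿ_; _*_ to _*ᴿ_)
  open RingOps R using (Σᴿ; Πᴿ; natᴿ; lhs; rhs; range)
  open Sums R
  open NatCoeffSolver commutativeSemiring using (solve; _:+_; _:*_; _:=_; con)
  open SetoidReasoning setoid

  1+x : ℕ → Carrier
  1+x j = 1# +ᴿ x j

  interval : ℕ → ℕ → List ℕ
  interval i zero    = []
  interval i (suc m) = i ∷ interval (suc i) m

  Π1+x : ℕ → ℕ → Carrier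
  Π1+x i m = Πᴿ (map 1+x (interval i m))

  descentWeight-descent : ∀ {i a b} → b < a → descentWeight i a b ≡ x i
  descentWeight-descent {i} {a} {b} b<a = ≡.cong (λ d → if d then x i else 1#) (dec-true (b <? a) b<a)

  descentWeight-ascent : ∀ {i a b} → ¬ b < a → descentWeight i a b ≡ 1#
  descentWeight-ascent {i} {a} {b} b≮a = ≡.cong (λ d → if d then x i else 1#) (dec-false (b <? a) b≮a)

  -- Arcs that do not wrap around (s + m + 1 ≤ N) are intervals of the order:
  -- the letter after a peeled left endpoint is larger and the letter after a
  -- peeled right endpoint is smaller, so each further letter contributes a
  -- factor 1 + x_j; the first letter descends from a iff a lies above the arc.
  straight-step : ∀ m a i s → s + suc (suc m) ≤ N →
    arcWeight a i s (suc (suc m)) ≈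
      descentWeight i a s *ᴿ Π1+x (suc (suc i)) m +ᴿ
      descentWeight i a (s + suc m) *ᴿ (x (suc i) *ᴿ Π1+x (suc (suc i)) m)
  straight-below : ∀ m a i s → s + suc m ≤ N → a ≤ s → arcWeight a i s (suc m) ≈ Π1+x (suc i) m
  straight-above : ∀ m a i s → s + suc m ≤ N → s + suc m ≤ a → arcWeight a i s (suc m) ≈ x i *ᴿ Π1+x (suc i) m

  straight-step m a i s bound = begin
    arcWeight a i s (suc (suc m))
      ≡⟨ ≡.cong₂ (λ u e → descentWeight i a s *ᴿ arcWeight s (suc i) u (suc m) +ᴿ
                          descentWeight i a e *ᴿ arcWeight e (suc i) s (suc m))
                 (m<n⇒m%n≡m s+1<N) (m<n⇒m%n≡m e<N) ⟩
    descentWeight i a s *ᴿ arcWeight s (suc i) (suc s) (suc m) +ᴿ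
    descentWeight i a (s + suc m) *ᴿ arcWeight (s + suc m) (suc i) s (suc m)
      ≈⟨ +-cong (*-congˡ (straight-below m s (suc i) (suc s) e<N (ℕP.n≤1+n s)))
                (*-congˡ (straight-above m (s + suc m) (suc i) s (ℕP.<⇒≤ e<N) ℕP.≤-refl)) ⟩
    descentWeight i a s *ᴿ Π1+x (suc (suc i)) m +ᴿ
    descentWeight i a (s + suc m) *ᴿ (x (suc i) *ᴿ Π1+x (suc (suc i)) m) ∎
    where
      e<N : s + suc m < N
      e<N = ≡.subst (_≤ N) (ℕP.+-suc s (suc m)) bound
      s+1<N : suc s < N
      s+1<N = ℕP.≤-<-trans (ℕP.m<m+n s (s≤s z≤n)) e<N

  straight-below zero a i s _ a≤s = reflexive (descentWeight-ascent (ℕP.≤⇒≯ a≤s))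
  straight-below (suc m) a i s bound a≤s = begin
    arcWeight a i s (suc (suc m))
      ≈⟨ straight-step m a i s bound ⟩
    descentWeight i a s *ᴿ P +ᴿ descentWeight i a (s + suc m) *ᴿ (x (suc i) *ᴿ P)
      ≡⟨ ≡.cong₂ (λ u v → u *ᴿ P +ᴿ v *ᴿ (x (suc i) *ᴿ P))
                 (descentWeight-ascent (ℕP.≤⇒≯ a≤s))
                 (descentWeight-ascent (ℕP.≤⇒≯ (ℕP.≤-trans a≤s (ℕP.m≤m+n s (suc m))))) ⟩
    1# *ᴿ P +ᴿ 1# *ᴿ (x (suc i) *ᴿ P)
      ≈⟨ solve 2 (λ y p → con 1 :* p :+ con 1 :* (y :* p) := (con 1 :+ y) :* p) refl (x (suc i)) P ⟩
    (1# +ᴿ x (suc i)) *ᴿ P ∎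
    where
      P : Carrier
      P = Π1+x (suc (suc i)) m

  straight-above zero a i s _ s+1≤a =
    trans (reflexive (descentWeight-descent (ℕP.<-≤-trans (ℕP.m<m+n s (s≤s z≤n)) s+1≤a))) (sym (*-identityʳ (x i)))
  straight-above (suc m) a i s bound s+m+2≤a = begin
    arcWeight a i s (suc (suc m))
      ≈⟨ straight-step m a i s bound ⟩
    descentWeight i a s *ᴿ P +ᴿ descentWeight i a (s + suc m) *ᴿ (x (suc i) *ᴿ P)
      ≡⟨ ≡.cong₂ (λ u v → u *ᴿ P +ᴿ v *ᴿ (x (suc i) *ᴿ P))
                 (descentWeight-descent (ℕP.<-≤-trans (ℕP.m<m+n s (s≤s z≤n)) s+m+2≤a))
                 (descentWeight-descent (ℕP.<-≤-trans (ℕP.+-monoʳ-< s (ℕP.n<1+n (suc m))) s+m+2≤a)) ⟩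
    x i *ᴿ P +ᴿ x i *ᴿ (x (suc i) *ᴿ P)
      ≈⟨ solve 3 (λ z y p → z :* p :+ z :* (y :* p) := z :* ((con 1 :+ y) :* p)) refl (x i) (x (suc i)) P ⟩
    x i *ᴿ ((1# +ᴿ x (suc i)) *ᴿ P) ∎
    where
      P : Carrier
      P = Π1+x (suc (suc i)) m

  -- Weights of wrapped arcs (top part of k+1 points, bottom part of r+1
  -- points), with the previous letter at index i:
  --   wrapped i k r     the previous letter lies strictly between the parts;
  --   afterLeft i k r   the left endpoint top k has just been peeled, so k top
  --                     points remain and the previous letter is above them;
  --   afterRight i k r  the right endpoint r has just been peeled, so r bottom
  --                     points remain and the previous letter is below them.
  afterLeft afterRight wrapped : ℕ → ℕ → ℕ → Carrier
  afterLeft i zero    r = x (suc i) *ᴿ Π1+x (suc (suc i)) r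
  afterLeft i (suc k) r = wrapped (suc i) k r
  afterRight i k zero    = Π1+x (suc (suc i)) k
  afterRight i k (suc r) = wrapped (suc i) k r
  wrapped i k r = afterLeft i k r +ᴿ x i *ᴿ afterRight i k r

  r+k+1≡k+r+1 : ∀ {k} r → r + suc k ≡ suc (k + r)
  r+k+1≡k+r+1 {k} r = ≡.trans (ℕP.+-suc r k) (≡.cong suc (ℕP.+-comm r k))

  arcWeight-afterLeft : ∀ i k r → suc (suc (k + r)) < N →
    arcWeight (top k) (suc i) (suc (top k) % N) (suc (k + r)) ≈ afterLeft i k r
  arcWeight-afterRight : ∀ i k r → suc (suc (k + r)) < N →
    arcWeight ((top k + suc (k + r)) % N) (suc i) (top k) (suc (k + r)) ≈ afterRight i k r
  arcWeight-wrapped : ∀ i k r a → suc (suc (k + r)) < N → r < a → a < top k →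
    arcWeight a i (top k) (suc (suc (k + r))) ≈ wrapped i k r

  -- after peeling top 0 = N-1 only the straight arc 0, …, r remains
  arcWeight-afterLeft i zero r bound = begin
    arcWeight (top 0) (suc i) (N % N) (suc r)
      ≡⟨ ≡.cong (λ s → arcWeight (top 0) (suc i) s (suc r)) (n%n≡0 N) ⟩
    arcWeight (top 0) (suc i) 0 (suc r)
      ≈⟨ straight-above r (top 0) (suc i) 0 (ℕP.<⇒≤ (ℕP.<-trans (ℕP.n<1+n _) bound)) r+1≤top ⟩
    x (suc i) *ᴿ Π1+x (suc (suc i)) r ∎
    where
      r+1≤top : suc r ≤ top 0
      r+1≤top = ℕP.m+n≤o⇒m≤o∸n (suc r) (≡.subst (_≤ N) (≡.cong suc (ℕP.+-comm 1 r)) (ℕP.<⇒≤ bound))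
  arcWeight-afterLeft i (suc k) r bound = begin
    arcWeight (top (suc k)) (suc i) (suc (top (suc k)) % N) (suc (suc (k + r)))
      ≡⟨ ≡.cong (λ s → arcWeight (top (suc k)) (suc i) s (suc (suc (k + r))))
                (≡.trans (≡.cong (_% N) (suc-top k k+2≤N)) (m<n⇒m%n≡m (ℕP.∸-monoʳ-< (s≤s z≤n) (ℕP.<⇒≤ k+2≤N)))) ⟩
    arcWeight (top (suc k)) (suc i) (top k) (suc (suc (k + r)))
      ≈⟨ arcWeight-wrapped (suc i) k r (top (suc k)) (ℕP.<-trans (ℕP.n<1+n _) bound) r<top
           (ℕP.≤-reflexive (suc-top k k+2≤N)) ⟩
    wrapped (suc i) k r ∎
    where
      k+2≤N : suc (suc k) ≤ N
      k+2≤N = ℕP.≤-trans (s≤s (s≤s (ℕP.m≤m+n k r))) (ℕP.<⇒≤ (ℕP.<-trans (ℕP.n<1+n _) bound))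
      r<top : r < top (suc k)
      r<top = ℕP.m+n≤o⇒m≤o∸n (suc r) (≡.subst (_≤ N) (≡.sym (≡.cong suc (r+k+1≡k+r+1 {suc k} r))) (ℕP.<⇒≤ bound))

  -- after peeling r = 0 only the straight top arc remains
  arcWeight-afterRight i k zero bound = begin
    arcWeight ((top k + suc (k + 0)) % N) (suc i) (top k) (suc (k + 0))
      ≡⟨ ≡.cong₂ (λ a m → arcWeight a (suc i) (top k) (suc m)) (top+length k 0 bound) (ℕP.+-identityʳ k) ⟩
    arcWeight 0 (suc i) (top k) (suc k)
      ≈⟨ straight-below k 0 (suc i) (top k) (ℕP.≤-reflexive (top+suc k k<N)) z≤n ⟩
    Π1+x (suc (suc i)) k ∎
    where
      k<N : suc k ≤ N
      k<N = ℕP.≤-trans (s≤s (ℕP.m≤m+n k 0)) (ℕP.<⇒≤ (ℕP.<-trans (ℕP.n<1+n _) bound))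
  arcWeight-afterRight i k (suc r) bound = begin
    arcWeight ((top k + suc (k + suc r)) % N) (suc i) (top k) (suc (k + suc r))
      ≡⟨ ≡.cong₂ (λ a m → arcWeight a (suc i) (top k) (suc m)) (top+length k (suc r) bound) (ℕP.+-suc k r) ⟩
    arcWeight (suc r) (suc i) (top k) (suc (suc (k + r)))
      ≈⟨ arcWeight-wrapped (suc i) k r (suc r) (ℕP.<-trans (ℕP.n<1+n _) bound′) (ℕP.n<1+n r) r+1<top ⟩
    wrapped (suc i) k r ∎
    where
      bound′ : suc (suc (suc (k + r))) < N
      bound′ = ≡.subst (λ z → suc (suc z) < N) (ℕP.+-suc k r) bound
      r+1<top : suc r < top k
      r+1<top = ℕP.m+n≤o⇒m≤o∸n (suc (suc r))
        (≡.subst (_≤ N) (≡.sym (≡.cong (λ z → suc (suc z)) (r+k+1≡k+r+1 r))) (ℕP.<⇒≤ bound′))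

  arcWeight-wrapped i k r a bound r<a a<top = begin
    descentWeight i a (top k) *ᴿ L +ᴿ descentWeight i a e *ᴿ R′
      ≡⟨ ≡.cong₂ (λ u v → u *ᴿ L +ᴿ v *ᴿ R′)
                 (descentWeight-ascent (ℕP.<-asym a<top))
                 (descentWeight-descent (≡.subst (_< a) (≡.sym (top+length k r bound)) r<a)) ⟩
    1# *ᴿ L +ᴿ x i *ᴿ R′
      ≈⟨ +-cong (trans (*-identityˡ L) (arcWeight-afterLeft i k r bound)) (*-congˡ (arcWeight-afterRight i k r bound)) ⟩
    wrapped i k r ∎
    where
      e : ℕ
      e = (top k + suc (k + r)) % N
      L R′ : Carrier
      L  = arcWeight (top k) (suc i) (suc (top k) % N) (suc (k + r))
      R′ = arcWeight e (suc i) (top k) (suc (k + r))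

  descentWeight-sentinel : ∀ b → descentWeight 0 0 b ≡ 1#
  descentWeight-sentinel b = descentWeight-ascent {0} {0} {b} (λ ())

  -- the N starts split into n+1 straight and n' + 1 = n-1 wrapped arcs
  N≡n+1+n' : suc n + suc n' ≡ N
  N≡n+1+n' = ≡.trans (≡.sym (ℕP.+-suc n (suc n'))) n+n≡N

  arcWeight-straight-start : ∀ s → s < suc n → arcWeight 0 0 s n ≈ Π1+x 1 (suc n')
  arcWeight-straight-start s (s≤s s≤n) =
    straight-below (suc n') 0 0 s (≡.subst (s + n ≤_) n+n≡N (ℕP.+-monoˡ-≤ n s≤n)) z≤n

  -- the other n-1 arcs wrap around: the top part has k+1 = n'-t+1 points
  arcWeight-wrapped-start : ∀ t → t < suc n' →
    arcWeight 0 0 (suc n + t) n ≈ afterLeft 0 (n' ∸ t) t +ᴿ afterRight 0 (n' ∸ t) t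
  arcWeight-wrapped-start t (s≤s t≤n') = begin
    arcWeight 0 0 (suc n + t) n
      ≡⟨ ≡.cong₂ (λ s m → arcWeight 0 0 s (suc (suc m))) (≡.sym start≡top) n'≡k+t ⟩
    descentWeight 0 0 (top k) *ᴿ arcWeight (top k) 1 (suc (top k) % N) (suc (k + t)) +ᴿ
    descentWeight 0 0 e *ᴿ arcWeight e 1 (top k) (suc (k + t))
      ≈⟨ +-cong (trans (*-congʳ (reflexive (descentWeight-sentinel (top k)))) (*-identityˡ _))
                (trans (*-congʳ (reflexive (descentWeight-sentinel e))) (*-identityˡ _)) ⟩
    arcWeight (top k) 1 (suc (top k) % N) (suc (k + t)) +ᴿ arcWeight e 1 (top k) (suc (k + t))
      ≈⟨ +-cong (arcWeight-afterLeft 0 k t bound) (arcWeight-afterRight 0 k t bound) ⟩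
    afterLeft 0 k t +ᴿ afterRight 0 k t ∎
    where
      k e : ℕ
      k = n' ∸ t
      e = (top k + suc (k + t)) % N
      n'≡k+t : n' ≡ k + t
      n'≡k+t = ≡.sym (ℕP.m∸n+n≡m t≤n')
      bound : suc (suc (k + t)) < N
      bound = ≡.subst (λ z → suc (suc z) < N) n'≡k+t n<N
      start≡top : top k ≡ suc n + t
      start≡top = top-of-start t k (≡.trans (ℕP.+-assoc (suc n) t (suc k))
        (≡.trans (≡.cong (suc n +_) (≡.trans (ℕP.+-suc t k) (≡.cong suc (ℕP.m+[n∸m]≡n t≤n')))) N≡n+1+n'))

  Σ-arcWeight : Σ< N (λ s → arcWeight 0 0 s n) ≈
                natᴿ (suc n) *ᴿ Π1+x 1 (suc n') +ᴿ (antidiag (afterLeft 0) n' 0 +ᴿ antidiag (afterRight 0) n' 0)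
  Σ-arcWeight = begin
    Σ< N A
      ≡⟨ ≡.cong (λ m → Σ< m A) (≡.sym N≡n+1+n') ⟩
    Σ< (suc n + suc n') A
      ≈⟨ Σ<-split (suc n) (suc n') A ⟩
    Σ< (suc n) A +ᴿ Σ< (suc n') (λ t → A (suc n + t))
      ≈⟨ +-cong (trans (Σ<-cong (suc n) arcWeight-straight-start) (Σ<-const (suc n) (Π1+x 1 (suc n'))))
                (Σ<-cong (suc n') arcWeight-wrapped-start) ⟩
    natᴿ (suc n) *ᴿ Π1+x 1 (suc n') +ᴿ Σ< (suc n') (λ t → afterLeft 0 (n' ∸ t) t +ᴿ afterRight 0 (n' ∸ t) t)
      ≈⟨ +-congˡ (sym (antidiag≈Σ< (λ k r → afterLeft 0 k r +ᴿ afterRight 0 k r) n' 0)) ⟩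
    natᴿ (suc n) *ᴿ Π1+x 1 (suc n') +ᴿ antidiag (λ k r → afterLeft 0 k r +ᴿ afterRight 0 k r) n' 0
      ≈⟨ +-congˡ (antidiag-+ (afterLeft 0) (afterRight 0) n' 0) ⟩
    natᴿ (suc n) *ᴿ Π1+x 1 (suc n') +ᴿ (antidiag (afterLeft 0) n' 0 +ᴿ antidiag (afterRight 0) n' 0) ∎
    where
      A : ℕ → Carrier
      A s = arcWeight 0 0 s n

  -- the antidiagonal sums of wrapped weights; they satisfy the recursion of
  -- the inner sum of the right-hand side
  wrappedSum : ℕ → ℕ → Carrier
  wrappedSum i k = antidiag (wrapped i) k 0

  -- along an antidiagonal, afterLeft and afterRight are shifted wrapped
  -- weights, up to one straight arc at the end
  antidiag-afterLeft : ∀ i k r →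
    antidiag (afterLeft i) (suc k) r ≈ antidiag (wrapped (suc i)) k r +ᴿ x (suc i) *ᴿ Π1+x (suc (suc i)) (suc (k + r))
  antidiag-afterLeft i zero    r = refl
  antidiag-afterLeft i (suc k) r = begin
    wrapped (suc i) (suc k) r +ᴿ antidiag (afterLeft i) (suc k) (suc r)
      ≈⟨ +-congˡ (antidiag-afterLeft i k (suc r)) ⟩
    wrapped (suc i) (suc k) r +ᴿ (antidiag (wrapped (suc i)) k (suc r) +ᴿ x (suc i) *ᴿ Π1+x (suc (suc i)) (suc (k + suc r)))
      ≈⟨ sym (+-assoc _ _ _) ⟩
    antidiag (wrapped (suc i)) (suc k) r +ᴿ x (suc i) *ᴿ Π1+x (suc (suc i)) (suc (k + suc r))
      ≡⟨ ≡.cong (λ m → antidiag (wrapped (suc i)) (suc k) r +ᴿ x (suc i) *ᴿ Π1+x (suc (suc i)) (suc m)) (ℕP.+-suc k r) ⟩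
    antidiag (wrapped (suc i)) (suc k) r +ᴿ x (suc i) *ᴿ Π1+x (suc (suc i)) (suc (suc (k + r))) ∎

  antidiag-afterRight : ∀ i k r → antidiag (afterRight i) k (suc r) ≡ antidiag (wrapped (suc i)) k r
  antidiag-afterRight i zero    r = ≡.refl
  antidiag-afterRight i (suc k) r = ≡.cong (wrapped (suc i) (suc k) r +ᴿ_) (antidiag-afterRight i k (suc r))

  wrappedSum-zero : ∀ i → wrappedSum i 0 ≈ x i +ᴿ x (suc i)
  wrappedSum-zero i = solve 2 (λ a b → b :* con 1 :+ a :* con 1 := a :+ b) refl (x i) (x (suc i))

  wrappedSum-suc : ∀ i k →
    wrappedSum i (suc k) ≈ (x i +ᴿ x (suc i)) *ᴿ Π1+x (suc (suc i)) (suc k) +ᴿ 1+x i *ᴿ wrappedSum (suc i) k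
  wrappedSum-suc i k = begin
    antidiag (λ a b → afterLeft i a b +ᴿ x i *ᴿ afterRight i a b) (suc k) 0
      ≈⟨ antidiag-+ (afterLeft i) (λ a b → x i *ᴿ afterRight i a b) (suc k) 0 ⟩
    antidiag (afterLeft i) (suc k) 0 +ᴿ antidiag (λ a b → x i *ᴿ afterRight i a b) (suc k) 0
      ≈⟨ +-cong (antidiag-afterLeft i k 0) (antidiag-*ˡ (x i) (afterRight i) (suc k) 0) ⟩
    (W +ᴿ x (suc i) *ᴿ Π1+x (suc (suc i)) (suc (k + 0))) +ᴿ x i *ᴿ (P +ᴿ antidiag (afterRight i) k 1)
      ≡⟨ ≡.cong₂ (λ m A → (W +ᴿ x (suc i) *ᴿ Π1+x (suc (suc i)) (suc m)) +ᴿ x i *ᴿ (P +ᴿ A))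
                 (ℕP.+-identityʳ k) (antidiag-afterRight i k 0) ⟩
    (W +ᴿ x (suc i) *ᴿ P) +ᴿ x i *ᴿ (P +ᴿ W)
      ≈⟨ solve 4 (λ a b w p → (w :+ b :* p) :+ a :* (p :+ w) := (a :+ b) :* p :+ (con 1 :+ a) :* w) refl (x i) (x (suc i)) W P ⟩
    (x i +ᴿ x (suc i)) *ᴿ P +ᴿ 1+x i *ᴿ W ∎
    where
      W P : Carrier
      W = wrappedSum (suc i) k
      P = Π1+x (suc (suc i)) (suc k)

  -- The inner sum of the right-hand side: for i ≤ j < i+m, the term
  -- (x_j + x_{j+1}) ∏ (1 + x_l) over the l ∈ [i, i+m] other than j, j+1.
  outside? : (j : ℕ) → Decidable (λ l → ¬ (l ≡ j ⊎ l ≡ suc j))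
  outside? j l = ¬? ((l ≟ j) ⊎-dec (l ≟ suc j))

  rhsTerm : List ℕ → ℕ → Carrier
  rhsTerm L j = (x j +ᴿ x (suc j)) *ᴿ Πᴿ (map 1+x (filter (outside? j) L))

  rhsSum : ℕ → ℕ → Carrier
  rhsSum i m = Σᴿ (map (rhsTerm (interval i (suc m))) (interval i m))

  interval-≥ : ∀ a k → All (a ≤_) (interval a k)
  interval-≥ a zero    = []
  interval-≥ a (suc k) = ℕP.≤-refl ∷ All.map (ℕP.≤-trans (ℕP.n≤1+n a)) (interval-≥ (suc a) k)

  rhsTerm-cons : ∀ i L js → All (i <_) js → Σᴿ (map (rhsTerm (i ∷ L)) js) ≈ 1+x i *ᴿ Σᴿ (map (rhsTerm L) js)
  rhsTerm-cons i L []       []           = sym (zeroʳ (1+x i))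
  rhsTerm-cons i L (j ∷ js) (i<j ∷ i<js) = begin
    (x j +ᴿ x (suc j)) *ᴿ Πᴿ (map 1+x (filter (outside? j) (i ∷ L))) +ᴿ Σᴿ (map (rhsTerm (i ∷ L)) js)
      ≡⟨ ≡.cong (λ l → (x j +ᴿ x (suc j)) *ᴿ Πᴿ (map 1+x l) +ᴿ Σᴿ (map (rhsTerm (i ∷ L)) js))
                (filter-accept (outside? j) i-outside) ⟩
    (x j +ᴿ x (suc j)) *ᴿ (1+x i *ᴿ Q) +ᴿ Σᴿ (map (rhsTerm (i ∷ L)) js)
      ≈⟨ +-congˡ (rhsTerm-cons i L js i<js) ⟩
    (x j +ᴿ x (suc j)) *ᴿ (1+x i *ᴿ Q) +ᴿ 1+x i *ᴿ Σᴿ (map (rhsTerm L) js)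
      ≈⟨ solve 4 (λ a b q t → a :* (b :* q) :+ b :* t := b :* (a :* q :+ t)) refl
                 (x j +ᴿ x (suc j)) (1+x i) Q (Σᴿ (map (rhsTerm L) js)) ⟩
    1+x i *ᴿ (rhsTerm L j +ᴿ Σᴿ (map (rhsTerm L) js)) ∎
    where
      Q : Carrier
      Q = Πᴿ (map 1+x (filter (outside? j) L))
      i-outside : ¬ (i ≡ j ⊎ i ≡ suc j)
      i-outside (inj₁ i≡j)  = ℕP.<-irrefl i≡j i<j
      i-outside (inj₂ i≡j+1) = ℕP.<-irrefl i≡j+1 (ℕP.<-trans i<j (ℕP.n<1+n j))

  rhsSum-suc : ∀ i k → rhsSum i (suc k) ≈ (x i +ᴿ x (suc i)) *ᴿ Π1+x (suc (suc i)) k +ᴿ 1+x i *ᴿ rhsSum (suc i) k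
  rhsSum-suc i k = +-cong (reflexive (≡.cong (λ l → (x i +ᴿ x (suc i)) *ᴿ Πᴿ (map 1+x l)) first-term))
                          (rhsTerm-cons i (interval (suc i) (suc k)) (interval (suc i) k) (interval-≥ (suc i) k))
    where
      first-term : filter (outside? i) (i ∷ suc i ∷ interval (suc (suc i)) k) ≡ interval (suc (suc i)) k
      first-term = ≡.trans (filter-reject (outside? i) (λ h → h (inj₁ ≡.refl)))
                   (≡.trans (filter-reject (outside? i) (λ h → h (inj₂ ≡.refl)))
                   (filter-all (outside? i) (All.map above (interval-≥ (suc (suc i)) k))))
        where
          above : ∀ {l} → suc (suc i) ≤ l → ¬ (l ≡ i ⊎ l ≡ suc i)
          above i+2≤l (inj₁ l≡i)   = ℕP.<-irrefl (≡.sym l≡i) (ℕP.<-trans (ℕP.n<1+n i) i+2≤l)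
          above i+2≤l (inj₂ l≡i+1) = ℕP.<-irrefl (≡.sym l≡i+1) i+2≤l

  -- the two recursions agree, hence so do the sums
  rhsSum≈wrappedSum : ∀ i k → rhsSum i (suc k) ≈ wrappedSum i k
  rhsSum≈wrappedSum i zero = begin
    rhsSum i 1
      ≈⟨ rhsSum-suc i 0 ⟩
    (x i +ᴿ x (suc i)) *ᴿ 1# +ᴿ 1+x i *ᴿ 0#
      ≈⟨ solve 2 (λ a b → (a :+ b) :* con 1 :+ (con 1 :+ a) :* con 0 := a :+ b) refl (x i) (x (suc i)) ⟩
    x i +ᴿ x (suc i)
      ≈⟨ sym (wrappedSum-zero i) ⟩
    wrappedSum i 0 ∎
  rhsSum≈wrappedSum i (suc k) = begin
    rhsSum i (suc (suc k))
      ≈⟨ rhsSum-suc i (suc k) ⟩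
    (x i +ᴿ x (suc i)) *ᴿ Π1+x (suc (suc i)) (suc k) +ᴿ 1+x i *ᴿ rhsSum (suc i) (suc k)
      ≈⟨ +-congˡ (*-congˡ (rhsSum≈wrappedSum (suc i) k)) ⟩
    (x i +ᴿ x (suc i)) *ᴿ Π1+x (suc (suc i)) (suc k) +ᴿ 1+x i *ᴿ wrappedSum (suc i) k
      ≈⟨ sym (wrappedSum-suc i k) ⟩
    wrappedSum i (suc k) ∎

  wrapped-total : ∀ i k → antidiag (afterLeft i) k 0 +ᴿ antidiag (afterRight i) k 0 ≈
                          Π1+x (suc i) (suc k) +ᴿ natᴿ 2 *ᴿ rhsSum (suc i) k
  wrapped-total i zero =
    solve 1 (λ y → y :* con 1 :+ con 1 := (con 1 :+ y) :* con 1 :+ (con 1 :+ (con 1 :+ con 0)) :* con 0) refl (x (suc i))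
  wrapped-total i (suc k) = begin
    antidiag (afterLeft i) (suc k) 0 +ᴿ (P +ᴿ antidiag (afterRight i) k 1)
      ≈⟨ +-cong (antidiag-afterLeft i k 0) (reflexive (≡.cong (P +ᴿ_) (antidiag-afterRight i k 0))) ⟩
    (W +ᴿ x (suc i) *ᴿ Π1+x (suc (suc i)) (suc (k + 0))) +ᴿ (P +ᴿ W)
      ≡⟨ ≡.cong (λ m → (W +ᴿ x (suc i) *ᴿ Π1+x (suc (suc i)) (suc m)) +ᴿ (P +ᴿ W)) (ℕP.+-identityʳ k) ⟩
    (W +ᴿ x (suc i) *ᴿ P) +ᴿ (P +ᴿ W)
      ≈⟨ solve 3 (λ y w p → (w :+ y :* p) :+ (p :+ w) := (con 1 :+ y) :* p :+ (con 1 :+ (con 1 :+ con 0)) :* w)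
               refl (x (suc i)) W P ⟩
    (1+x (suc i)) *ᴿ P +ᴿ natᴿ 2 *ᴿ W
      ≈⟨ +-congˡ (*-congˡ (sym (rhsSum≈wrappedSum (suc i) k))) ⟩
    Π1+x (suc i) (suc (suc k)) +ᴿ natᴿ 2 *ᴿ rhsSum (suc i) (suc k) ∎
    where
      W P : Carrier
      W = wrappedSum (suc i) k
      P = Π1+x (suc (suc i)) (suc k)

  applyUpTo≡interval : ∀ m (f : ℕ → ℕ) i → (∀ t → f t ≡ i + t) → applyUpTo f m ≡ interval i m
  applyUpTo≡interval zero    f i f≗ = ≡.refl
  applyUpTo≡interval (suc m) f i f≗ = ≡.cong₂ _∷_ (≡.trans (f≗ 0) (ℕP.+-identityʳ i))
    (applyUpTo≡interval m (λ t → f (suc t)) (suc i) (λ t → ≡.trans (f≗ (suc t)) (ℕP.+-suc i t)))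

  range≡interval : ∀ m → range 1 m ≡ interval 1 m
  range≡interval m = ≡.trans (map-applyUpTo (λ t → t) (1 +_) m) (applyUpTo≡interval m (1 +_) 1 (λ _ → ≡.refl))

  rhs-unfold : ∀ m → rhs m x ≡ natᴿ (2 + m) *ᴿ Πᴿ (map 1+x (range 1 (m ∸ 1))) +ᴿ
                               natᴿ 2 *ᴿ Σᴿ (map (rhsTerm (range 1 (m ∸ 1))) (range 1 (m ∸ 2)))
  rhs-unfold m = ≡.refl

  rhs≡ : rhs n x ≡ natᴿ (2 + n) *ᴿ Π1+x 1 (suc n') +ᴿ natᴿ 2 *ᴿ rhsSum 1 n'
  rhs≡ = ≡.trans (rhs-unfold n)
    (≡.cong₂ (λ L M → natᴿ (2 + n) *ᴿ Πᴿ (map 1+x L) +ᴿ natᴿ 2 *ᴿ Σᴿ (map (rhsTerm L) M))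
             (range≡interval (suc n')) (range≡interval n'))

  -- Theorem 5.11 for n = n' + 2 letters: n+1 straight arcs and the wrapped
  -- arcs, which contribute one more product and twice the inner sum.
  evaluation : lhs n x ≈ rhs n x
  evaluation = begin
    lhs n x
      ≈⟨ lhs≈Σ-arcWeight ⟩
    Σ< N (λ s → arcWeight 0 0 s n)
      ≈⟨ Σ-arcWeight ⟩
    natᴿ (suc n) *ᴿ P +ᴿ (antidiag (afterLeft 0) n' 0 +ᴿ antidiag (afterRight 0) n' 0)
      ≈⟨ +-congˡ (wrapped-total 0 n') ⟩
    natᴿ (suc n) *ᴿ P +ᴿ (P +ᴿ natᴿ 2 *ᴿ S)
      ≈⟨ solve 3 (λ m p t → m :* p :+ (p :+ t) := (con 1 :+ m) :* p :+ t) refl (natᴿ (suc n)) P (natᴿ 2 *ᴿ S) ⟩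
    natᴿ (2 + n) *ᴿ P +ᴿ natᴿ 2 *ᴿ S
      ≡⟨ rhs≡ ⟨
    rhs n x ∎
    where
      P S : Carrier
      P = Π1+x 1 (suc n')
      S = rhsSum 1 n'

theorem5p11 : {c ℓ : Level} (R : CommutativeRing c ℓ) (n : ℕ) → 2 ≤ n →
    (x : ℕ → CommutativeRing.Carrier R) →
    CommutativeRing._≈_ R (RingOps.lhs R n x) (RingOps.rhs R n x)
theorem5p11 R (suc (suc n')) (s≤s (s≤s z≤n)) x = Evaluation.evaluation R n' x
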